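{- Let $n$ and $k$ be given positive integers. Then, as functions of the positive integer $d$, both $$\sum_{\lambda\in \mathcal{C}_{n,dn+1}}|\lambda|^k \qquad\text{and}\qquad \sum_{\lambda\in \mathcal{C}_{n,dn-1}}|\lambda|^k$$ are polynomials in $d$ of degree at most $2k+\lfloor n/2\rfloor$.
   Context: A partition $\lambda=(\lambda_1\ge\dots\ge\lambda_\ell)$ has size $|\lambda|=\sum_i\lambda_i$. The hook length of a box of its Young diagram is the number of boxes directly to its right, directly below it, plus the box itself. For a positive integer $t$, $\lambda$ is a $t$-core if none of its hook lengths is divisible by $t$; an $(s,t)$-core is both an $s$-core and a $t$-core. $\mathcal{C}_{n,dn+1}$ (resp. $\mathcal{C}_{n,dn-1}$) denotes the set of $(n,dn+1)$-core (resp. $(n,dn-1)$-core) partitions with distinct parts. -}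

module Defs where

open import Data.Nat using (ℕ; zero; suc; _+_; _*_; _∸_; _^_; _≤_; _<_; _>_; _<?_)
open import Data.Nat.Divisibility using (_∣_)
open import Data.List using (List; []; _∷_; length; filter; map; upTo; zip; concat)
open import Data.Nat.ListAction using (sum)
open import Data.List.Relation.Unary.All using (All)
open import Data.List.Relation.Unary.Linked using (Linked)
open import Data.List.Relation.Unary.Unique.Propositional using (Unique)
open import Data.List.Membership.Propositional using (_∈_)
open import Data.Product using (_×_)
open import Relation.Nullary using (¬_)
open import Data.Rational using (ℚ; 0ℚ) renaming (_+_ to _+ℚ_; _*_ to _*ℚ_)
import Data.Rational as ℚ

-- A partition is represented by the list of its parts (λ₁, λ₂, …, λ_ℓ).
-- "Partition with distinct parts": all parts positive and strictly decreasing.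
DistinctPartition : List ℕ → Set
DistinctPartition λs = All (0 <_) λs × Linked _>_ λs

size : List ℕ → ℕ
size = sum

colLen : ℕ → List ℕ → ℕ
colLen j λs = length (filter (j <?_) λs)

-- hook lengths of the boxes in row i (0-indexed) with part p:
-- box (i,j), j < p: arm = p - j - 1, leg = λ'_j - i - 1, hook = arm + leg + 1
rowHooks : List ℕ → ℕ → ℕ → List ℕ
rowHooks λs i p = map (λ j → (p ∸ j ∸ 1) + (colLen j λs ∸ i ∸ 1) + 1) (upTo p)

hooks : List ℕ → List ℕ
hooks λs = concat (map (λ ip → rowHooks λs (Data.Product.proj₁ ip) (Data.Product.proj₂ ip))
                       (zip (upTo (length λs)) λs))

IsCore : ℕ → List ℕ → Set
IsCore t λs = All (λ h → ¬ (t ∣ h)) (hooks λs)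

InC : ℕ → ℕ → List ℕ → Set
InC s t λs = DistinctPartition λs × IsCore s λs × IsCore t λs

Enumerates : ℕ → ℕ → List (List ℕ) → Set
Enumerates s t L = Unique L × (∀ λs → (λs ∈ L → InC s t λs) × (InC s t λs → λs ∈ L))

evalPoly : List ℚ → ℕ → ℚ
evalPoly [] d = 0ℚ
evalPoly (c ∷ cs) d = c +ℚ (ℚ._/_ (Data.Integer.+ d) 1 *ℚ evalPoly cs d)
  where import Data.Integer

powerSum : ℕ → List (List ℕ) → ℚ
powerSum k L = ℚ._/_ (Data.Integer.+ sum (map (λ λs → size λs ^ k) L)) 1
  where import Data.Integer

-- "f(d), d ≥ 1, is given by a polynomial in d of degree ≤ m, where f(d) is the
-- sum of |λ|^k over C_{n, g(d)}": the polynomial has at most m+1 coefficients,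
-- and for each d ≥ 1 the (finite) set C_{n,g(d)} has an enumeration whose power
-- sum equals the polynomial's value at d.
PolyInDOfDegAtMost : ℕ → ℕ → (ℕ → ℕ) → ℕ → Set
PolyInDOfDegAtMost n k g m =
  Data.Product.∃ λ (cs : List ℚ) → length cs ≤ suc m ×
    (∀ d → 1 ≤ d → Data.Product.∃ λ L → Enumerates n (g d) L × powerSum k L ≡ evalPoly cs d)
  where open import Relation.Binary.PropositionalEquality using (_≡_)

module Submission where

-- Write n = n' + 1.  A distinct partition λ is encoded by its
-- beta-set β(λ) = {λᵢ + ℓ - i}; its hooks are the differences b - x with b ∈ β, x ∉ β.
-- So λ is an n-core iff β = {k + 1 + j·n : k < n', j < mₖ} for a vector m ∈ ℕ^n' with no
-- two adjacent positive entries, and |λ| is then quadratic in m.  For t = dn ± 1 the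
-- t-core condition becomes a box m ≤ b(d) with b(d) affine in d.  Degrees are measured
-- by finite differences: |λ(m)|^k has degree ≤ 2k, each of the at most ⌈n'/2⌉ = ⌊n/2⌋
-- nonzero coordinates adds one summation, hence one degree; Newton's forward difference
-- formula turns the result into an explicit polynomial in d.

open import Data.Nat using (ℕ)

-- The embedding of ℕ into ℚ used by the statement, n ↦ n / 1, and its homomorphism
-- properties.  It is kept opaque so that ℚ-normalisation is never unfolded.
module NatEmbedding where
  open import Data.Nat as ℕ using (ℕ; zero; suc)
  import Data.Integer as ℤ
  import Data.Integer.Properties as ℤP
  open import Data.List using (List; []; _∷_; map)
  open import Data.Nat.ListAction using (sum)
  open import Data.Rational as ℚ using (ℚ; mkℚ; _+_; _*_; 0ℚ; 1ℚ)
  import Data.Rational.Properties as ℚP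
  open import Data.Nat.Coprimality using (1-coprimeTo) renaming (sym to coprime-sym)
  open import Relation.Binary.PropositionalEquality

  opaque
    toℚ : ℕ → ℚ
    toℚ n = ℚ._/_ (ℤ.+ n) 1

    toℚ-def : ∀ n → toℚ n ≡ ℚ._/_ (ℤ.+ n) 1
    toℚ-def n = refl

  toℚ-canonical : ∀ n → toℚ n ≡ mkℚ (ℤ.+ n) 0 (coprime-sym (1-coprimeTo n))
  toℚ-canonical n = trans (toℚ-def n) (ℚP.normalize-coprime (coprime-sym (1-coprimeTo n)))

  toℚ-0 : toℚ 0 ≡ 0ℚ
  toℚ-0 = toℚ-canonical 0

  toℚ-1 : toℚ 1 ≡ 1ℚ
  toℚ-1 = toℚ-canonical 1

  toℚ-+ : ∀ a b → toℚ (a ℕ.+ b) ≡ toℚ a + toℚ b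
  toℚ-+ a b = trans (trans (toℚ-def _) (cong (λ z → ℚ._/_ z 1) e))
                    (sym (cong₂ _+_ (toℚ-canonical a) (toℚ-canonical b)))
    where e : ℤ.+ (a ℕ.+ b) ≡ (ℤ.+ a ℤ.* ℤ.+ 1) ℤ.+ (ℤ.+ b ℤ.* ℤ.+ 1)
          e = cong₂ ℤ._+_ (sym (ℤP.*-identityʳ (ℤ.+ a))) (sym (ℤP.*-identityʳ (ℤ.+ b)))

  toℚ-* : ∀ a b → toℚ (a ℕ.* b) ≡ toℚ a * toℚ b
  toℚ-* a b = trans (trans (toℚ-def _) (cong (λ z → ℚ._/_ z 1) (ℤP.pos-* a b)))
                    (sym (cong₂ _*_ (toℚ-canonical a) (toℚ-canonical b)))

  toℚ-suc : ∀ n → toℚ (suc n) ≡ 1ℚ + toℚ n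
  toℚ-suc n = trans (toℚ-+ 1 n) (cong (_+ toℚ n) toℚ-1)

  pow : ℚ → ℕ → ℚ
  pow q zero = 1ℚ
  pow q (suc k) = q * pow q k

  sumℚ : List ℚ → ℚ
  sumℚ [] = 0ℚ
  sumℚ (x ∷ xs) = x + sumℚ xs

  toℚ-^ : ∀ a k → toℚ (a ℕ.^ k) ≡ pow (toℚ a) k
  toℚ-^ a zero = toℚ-1
  toℚ-^ a (suc k) = trans (toℚ-* a (a ℕ.^ k)) (cong (toℚ a *_) (toℚ-^ a k))

  toℚ-sum : ∀ {A : Set} (h : A → ℕ) xs → toℚ (sum (map h xs)) ≡ sumℚ (map (λ x → toℚ (h x)) xs)
  toℚ-sum h [] = toℚ-0
  toℚ-sum h (x ∷ xs) = trans (toℚ-+ (h x) (sum (map h xs))) (cong (toℚ (h x) +_) (toℚ-sum h xs))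

-- Finite differences on a set X with a right-commutative action ⊕ (translations).
-- `DegLt D f` says that every D-fold difference Δ_{s₁} ⋯ Δ_{s_D} f vanishes, i.e. f is a
-- "polynomial of degree < D" on X.
module FiniteDifferences where
  open import Data.Nat as ℕ using (ℕ; zero; suc; _≤_; z≤n; s≤s)
  import Data.Nat.Properties as ℕP
  open import Data.Rational using (ℚ; 0ℚ; 1ℚ; _+_; _*_; _-_; -_)
  open import Data.Rational.Solver
  open +-*-Solver
  open import Data.Unit using (⊤; tt)
  open import Data.Product using (_×_; _,_; proj₁; proj₂)
  open import Data.Vec using (Vec; []; _∷_)
  open import Relation.Binary.PropositionalEquality
  open NatEmbedding using (pow)

  record Shifts (X : Set) : Set where
    field
      _⊕_ : X → X → X
      ⊕-swap : ∀ x s t → (x ⊕ s) ⊕ t ≡ (x ⊕ t) ⊕ s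

  private
    diff-+ : ∀ a b c d → (a + b) - (c + d) ≡ (a - c) + (b - d)
    diff-+ = solve 4 (λ a b c d → (a :+ b) :- (c :+ d) := (a :- c) :+ (b :- d)) refl
    diff-* : ∀ a b c d → (a * b) - (c * d) ≡ (a - c) * b + c * (b - d)
    diff-* = solve 4 (λ a b c d → (a :* b) :- (c :* d) := (a :- c) :* b :+ c :* (b :- d)) refl
    diff-scale : ∀ q a c → q * a - q * c ≡ q * (a - c)
    diff-scale = solve 3 (λ q a c → q :* a :- q :* c := q :* (a :- c)) refl
    diff-self : ∀ q → q - q ≡ 0ℚ
    diff-self = solve 1 (λ q → q :- q := con 0ℚ) refl
    zero-* : ∀ a → 0ℚ * a ≡ 0ℚ
    zero-* = solve 1 (λ a → con 0ℚ :* a := con 0ℚ) refl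
    *-zero : ∀ a → a * 0ℚ ≡ 0ℚ
    *-zero = solve 1 (λ a → a :* con 0ℚ := con 0ℚ) refl
    neg-one-* : ∀ a → (- 1ℚ) * a ≡ - a
    neg-one-* = solve 1 (λ a → (:- con 1ℚ) :* a := :- a) refl

  sumTo : (ℕ → ℚ) → ℕ → ℚ
  sumTo h zero = 0ℚ
  sumTo h (suc a) = sumTo h a + h (suc a)

  module Differences {X : Set} (S : Shifts X) where
    open Shifts S

    Δ : X → (X → ℚ) → X → ℚ
    Δ s f x = f (x ⊕ s) - f x

    DegLt : ℕ → (X → ℚ) → Set
    DegLt zero f = ∀ x → f x ≡ 0ℚ
    DegLt (suc D) f = ∀ s → DegLt D (Δ s f)

    DegLt-cong : ∀ D {f g} → (∀ x → f x ≡ g x) → DegLt D f → DegLt D g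
    DegLt-cong zero e d x = trans (sym (e x)) (d x)
    DegLt-cong (suc D) e d s = DegLt-cong D (λ x → cong₂ _-_ (e (x ⊕ s)) (e x)) (d s)

    DegLt-zero : ∀ D {f} → (∀ x → f x ≡ 0ℚ) → DegLt D f
    DegLt-zero zero z = z
    DegLt-zero (suc D) z s = DegLt-zero D (λ x → cong₂ _-_ (z (x ⊕ s)) (z x))

    DegLt-suc : ∀ D {f} → DegLt D f → DegLt (suc D) f
    DegLt-suc zero d = DegLt-zero 1 d
    DegLt-suc (suc D) d s = DegLt-suc D (d s)

    DegLt-≤ : ∀ {D E f} → D ≤ E → DegLt D f → DegLt E f
    DegLt-≤ {zero} {zero} z≤n d = d
    DegLt-≤ {zero} {suc E} z≤n d = DegLt-suc E (DegLt-≤ {zero} {E} z≤n d)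
    DegLt-≤ {suc D} {suc E} (s≤s le) d s = DegLt-≤ le (d s)

    DegLt-+ : ∀ D {f g} → DegLt D f → DegLt D g → DegLt D (λ x → f x + g x)
    DegLt-+ zero df dg x = cong₂ _+_ (df x) (dg x)
    DegLt-+ (suc D) {f} {g} df dg s =
      DegLt-cong D (λ x → sym (diff-+ (f (x ⊕ s)) (g (x ⊕ s)) (f x) (g x))) (DegLt-+ D (df s) (dg s))

    DegLt-scale : ∀ D q {f} → DegLt D f → DegLt D (λ x → q * f x)
    DegLt-scale zero q df x = trans (cong (q *_) (df x)) (*-zero q)
    DegLt-scale (suc D) q {f} df s =
      DegLt-cong D (λ x → sym (diff-scale q (f (x ⊕ s)) (f x))) (DegLt-scale D q (df s))

    DegLt-- : ∀ D {f g} → DegLt D f → DegLt D g → DegLt D (λ x → f x - g x)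
    DegLt-- D {f} {g} df dg =
      DegLt-cong D (λ x → cong (f x +_) (neg-one-* (g x))) (DegLt-+ D {f} {λ x → (- 1ℚ) * g x} df (DegLt-scale D (- 1ℚ) {g} dg))

    DegLt-const : ∀ q → DegLt 1 (λ _ → q)
    DegLt-const q s x = diff-self q

    -- Translating the argument preserves the degree (this uses right-commutativity).
    DegLt-shift : ∀ D s {f} → DegLt D f → DegLt D (λ x → f (x ⊕ s))
    DegLt-shift zero s df x = df (x ⊕ s)
    DegLt-shift (suc D) s {f} df t =
      DegLt-cong D (λ x → cong (λ z → f z - f (x ⊕ s)) (⊕-swap x s t)) (DegLt-shift D s (df t))

    -- Leibniz rule Δ(fg) = Δf · g(· ⊕ s) + f · Δg gives the degree of a product.
    DegLt-* : ∀ a b {f g} → DegLt (suc a) f → DegLt (suc b) g → DegLt (suc (a ℕ.+ b)) (λ x → f x * g x)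
    DegLt-* a b {f} {g} df dg s =
      DegLt-cong (a ℕ.+ b) (λ x → sym (diff-* (f (x ⊕ s)) (g (x ⊕ s)) (f x) (g x)))
        (DegLt-+ (a ℕ.+ b) {λ x → Δ s f x * g (x ⊕ s)} {λ x → f x * Δ s g x} (left a b {f} {g} df dg) (right a b {f} {g} df dg))
      where
      left : ∀ a b {f g} → DegLt (suc a) f → DegLt (suc b) g → DegLt (a ℕ.+ b) (λ x → Δ s f x * g (x ⊕ s))
      left zero b {f} {g} df dg = DegLt-zero b (λ x → trans (cong (_* g (x ⊕ s)) (df s x)) (zero-* (g (x ⊕ s))))
      left (suc a) b {f} {g} df dg = DegLt-* a b {Δ s f} {λ x → g (x ⊕ s)} (df s) (DegLt-shift (suc b) s {g} dg)
      right : ∀ a b {f g} → DegLt (suc a) f → DegLt (suc b) g → DegLt (a ℕ.+ b) (λ x → f x * Δ s g x)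
      right a zero {f} {g} df dg = DegLt-zero (a ℕ.+ 0) (λ x → trans (cong (f x *_) (dg s x)) (*-zero (f x)))
      right a (suc b) {f} {g} df dg =
        subst (λ k → DegLt k (λ x → f x * Δ s g x)) (sym (ℕP.+-suc a b)) (DegLt-* a b {f} {Δ s g} df (dg s))

    DegLt-pow : ∀ a k {f} → DegLt (suc a) f → DegLt (suc (k ℕ.* a)) (λ x → pow (f x) k)
    DegLt-pow a zero df = DegLt-const 1ℚ
    DegLt-pow a (suc k) {f} df = DegLt-* a (k ℕ.* a) {f} {λ x → pow (f x) k} df (DegLt-pow a k {f} df)

    DegLt-sumTo : ∀ D (h : ℕ → X → ℚ) → (∀ i → DegLt D (h i)) → ∀ c → DegLt D (λ x → sumTo (λ i → h i x) c)
    DegLt-sumTo D h dh zero = DegLt-zero D (λ x → refl)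
    DegLt-sumTo D h dh (suc c) = DegLt-+ D {λ x → sumTo (λ i → h i x) c} {h (suc c)} (DegLt-sumTo D h dh c) (dh (suc c))

  DegLt-pull : ∀ {X Y : Set} (SX : Shifts X) (SY : Shifts Y) D (π : X → Y) (L : X → Y) →
               (∀ x s → π (Shifts._⊕_ SX x s) ≡ Shifts._⊕_ SY (π x) (L s)) →
               ∀ {f} → Differences.DegLt SY D f → Differences.DegLt SX D (λ x → f (π x))
  DegLt-pull SX SY zero π L e df x = df (π x)
  DegLt-pull SX SY (suc D) π L e {f} df s =
    Differences.DegLt-cong SX D (λ x → cong (λ z → f z - f (π x)) (sym (e x s)))
      (DegLt-pull SX SY D π L e (df (L s)))

  ℕ-shifts : Shifts ℕ
  ℕ-shifts = record { _⊕_ = λ x s → s ℕ.+ x ; ⊕-swap = swap }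
    where swap : ∀ x s t → t ℕ.+ (s ℕ.+ x) ≡ s ℕ.+ (t ℕ.+ x)
          swap x s t = trans (sym (ℕP.+-assoc t s x)) (trans (cong (ℕ._+ x) (ℕP.+-comm t s)) (ℕP.+-assoc s t x))

  ⊤-shifts : Shifts ⊤
  ⊤-shifts = record { _⊕_ = λ _ _ → tt ; ⊕-swap = λ _ _ _ → refl }

  ×-shifts : ∀ {X Y} → Shifts X → Shifts Y → Shifts (X × Y)
  ×-shifts SX SY = record
    { _⊕_ = λ p q → (proj₁ p ⊕x proj₁ q) , (proj₂ p ⊕y proj₂ q)
    ; ⊕-swap = λ p q r → cong₂ _,_ (swapx (proj₁ p) (proj₁ q) (proj₁ r)) (swapy (proj₂ p) (proj₂ q) (proj₂ r)) }
    where open Shifts SX renaming (_⊕_ to _⊕x_; ⊕-swap to swapx)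
          open Shifts SY renaming (_⊕_ to _⊕y_; ⊕-swap to swapy)

  _⊕v_ : ∀ {v} → Vec ℕ v → Vec ℕ v → Vec ℕ v
  [] ⊕v [] = []
  (a ∷ as) ⊕v (b ∷ bs) = (b ℕ.+ a) ∷ (as ⊕v bs)

  Vec-shifts : ∀ v → Shifts (Vec ℕ v)
  Vec-shifts v = record { _⊕_ = _⊕v_ ; ⊕-swap = swap }
    where swap : ∀ {v} (x s t : Vec ℕ v) → (x ⊕v s) ⊕v t ≡ (x ⊕v t) ⊕v s
          swap [] [] [] = refl
          swap (a ∷ x) (b ∷ s) (c ∷ t) = cong₂ _∷_ (Shifts.⊕-swap ℕ-shifts a b c) (swap x s t)

module DegreeLemmas where
  open import Data.Nat as ℕ using (ℕ; zero; suc)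
  open import Data.Rational using (ℚ; 0ℚ; _+_; _*_; _-_)
  open import Data.Rational.Solver
  open +-*-Solver
  open import Data.Product using (_×_; _,_; proj₁)
  open import Relation.Binary.PropositionalEquality
  open NatEmbedding
  open FiniteDifferences

  choose2 : ℕ → ℕ
  choose2 zero = 0
  choose2 (suc a) = a ℕ.+ choose2 a

  choose2-+ : ∀ a b → choose2 (a ℕ.+ b) ≡ choose2 a ℕ.+ a ℕ.* b ℕ.+ choose2 b
  choose2-+ zero b = refl
  choose2-+ (suc a) b rewrite choose2-+ a b = rearrange a b (choose2 a) (choose2 b)
    where
    open import Data.Nat.Solver as NS using ()
    open NS.+-*-Solver renaming (solve to nsolve; _:=_ to _:=n_; _:+_ to _:+n_; _:*_ to _:*n_)
    rearrange : ∀ a b x y → a ℕ.+ b ℕ.+ (x ℕ.+ a ℕ.* b ℕ.+ y) ≡ a ℕ.+ x ℕ.+ (b ℕ.+ a ℕ.* b) ℕ.+ y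
    rearrange = nsolve 4 (λ a b x y → a :+n b :+n (x :+n a :*n b :+n y) :=n a :+n x :+n (b :+n a :*n b) :+n y) refl

  module _ {X : Set} (S : Shifts X) where
    open Differences S
    open Shifts S

    DegLt-additive : (g : X → ℕ) → (∀ x s → g (x ⊕ s) ≡ g x ℕ.+ g s) → DegLt 2 (λ x → toℚ (g x))
    DegLt-additive g e s = DegLt-cong 1 (λ x → sym (Δg x)) (DegLt-const (toℚ (g s)))
      where
      Δg : ∀ x → toℚ (g (x ⊕ s)) - toℚ (g x) ≡ toℚ (g s)
      Δg x = trans (cong (λ z → toℚ z - toℚ (g x)) (e x s))
               (trans (cong (_- toℚ (g x)) (toℚ-+ (g x) (g s)))
                      (solve 2 (λ p q → (p :+ q) :- p := q) refl (toℚ (g x)) (toℚ (g s))))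

    DegLt-choose2 : (g : X → ℕ) → (∀ x s → g (x ⊕ s) ≡ g x ℕ.+ g s) → DegLt 3 (λ x → toℚ (choose2 (g x)))
    DegLt-choose2 g e s = DegLt-cong 2 (λ x → sym (Δchoose x))
      (DegLt-+ 2 {λ x → toℚ (g s) * toℚ (g x)} {λ _ → toℚ (choose2 (g s))}
        (DegLt-scale 2 (toℚ (g s)) {λ x → toℚ (g x)} (DegLt-additive g e))
        (DegLt-suc 1 {λ _ → toℚ (choose2 (g s))} (DegLt-const (toℚ (choose2 (g s))))))
      where
      open ≡-Reasoning
      Δchoose : ∀ x → toℚ (choose2 (g (x ⊕ s))) - toℚ (choose2 (g x)) ≡ toℚ (g s) * toℚ (g x) + toℚ (choose2 (g s))
      Δchoose x = begin
        toℚ (choose2 (g (x ⊕ s))) - toℚ (choose2 (g x))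
          ≡⟨ cong (λ z → toℚ z - toℚ (choose2 (g x))) (trans (cong choose2 (e x s)) (choose2-+ (g x) (g s))) ⟩
        toℚ (choose2 (g x) ℕ.+ g x ℕ.* g s ℕ.+ choose2 (g s)) - toℚ (choose2 (g x))
          ≡⟨ cong (_- toℚ (choose2 (g x))) (trans (toℚ-+ _ _) (cong (_+ toℚ (choose2 (g s)))
               (trans (toℚ-+ _ _) (cong (toℚ (choose2 (g x)) +_) (toℚ-* (g x) (g s)))))) ⟩
        ((toℚ (choose2 (g x)) + toℚ (g x) * toℚ (g s)) + toℚ (choose2 (g s))) - toℚ (choose2 (g x))
          ≡⟨ solve 4 (λ p a b r → ((p :+ a :* b) :+ r) :- p := b :* a :+ r) refl
               (toℚ (choose2 (g x))) (toℚ (g x)) (toℚ (g s)) (toℚ (choose2 (g s))) ⟩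
        toℚ (g s) * toℚ (g x) + toℚ (choose2 (g s)) ∎

  module _ {Y : Set} (SY : Shifts Y) where
    open Differences (×-shifts ℕ-shifts SY)
    open Shifts (×-shifts ℕ-shifts SY)
    open Shifts SY using () renaming (_⊕_ to _⊕y_)

    partialSum : (ℕ × Y → ℚ) → ℕ × Y → ℚ
    partialSum G (a , y) = sumTo (λ j → G (j , y)) a

    private
      sumTo-split : ∀ h a c → sumTo h (c ℕ.+ a) ≡ sumTo h a + sumTo (λ i → h (i ℕ.+ a)) c
      sumTo-split h a zero = solve 1 (λ x → x := x :+ con 0ℚ) refl (sumTo h a)
      sumTo-split h a (suc c) rewrite sumTo-split h a c =
        solve 3 (λ x y z → x :+ y :+ z := x :+ (y :+ z)) refl (sumTo h a) (sumTo (λ i → h (i ℕ.+ a)) c) (h (suc (c ℕ.+ a)))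
      sumTo-- : ∀ h₁ h₂ a → sumTo h₁ a - sumTo h₂ a ≡ sumTo (λ j → h₁ j - h₂ j) a
      sumTo-- h₁ h₂ zero = refl
      sumTo-- h₁ h₂ (suc a) rewrite sym (sumTo-- h₁ h₂ a) =
        solve 4 (λ x y z w → x :+ y :- (z :+ w) := x :- z :+ (y :- w)) refl (sumTo h₁ a) (h₁ (suc a)) (sumTo h₂ a) (h₂ (suc a))
      sumTo-zero : ∀ h a → (∀ j → h j ≡ 0ℚ) → sumTo h a ≡ 0ℚ
      sumTo-zero h zero z = refl
      sumTo-zero h (suc a) z rewrite sumTo-zero h a z | z (suc a) = refl

    Δ-partialSum : ∀ G c s p → Δ (c , s) (partialSum G) p ≡
                   partialSum (Δ (0 , s) G) p + sumTo (λ i → G (p ⊕ (i , s))) c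
    Δ-partialSum G c s (a , y) =
      trans (cong (_- sumTo (λ j → G (j , y)) a) (sumTo-split (λ j → G (j , y ⊕y s)) a c))
        (trans (solve 3 (λ p q r → p :+ q :- r := (p :- r) :+ q) refl
                  (sumTo (λ j → G (j , y ⊕y s)) a) (sumTo (λ i → G (i ℕ.+ a , y ⊕y s)) c) (sumTo (λ j → G (j , y)) a))
               (cong (_+ sumTo (λ i → G (i ℕ.+ a , y ⊕y s)) c) (sumTo-- (λ j → G (j , y ⊕y s)) (λ j → G (j , y)) a)))

    DegLt-partialSum : ∀ D G → DegLt D G → DegLt (suc D) (partialSum G)
    DegLt-partialSum D G dG (c , s) = DegLt-cong D (λ p → sym (Δ-partialSum G c s p))
      (DegLt-+ D {partialSum (Δ (0 , s) G)} {λ p → sumTo (λ i → G (p ⊕ (i , s))) c} (first D dG) translates)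
      where
      first : ∀ D → DegLt D G → DegLt D (partialSum (Δ (0 , s) G))
      first zero dG p = sumTo-zero _ (proj₁ p) (λ j → cong₂ _-_ (dG _) (dG _))
      first (suc D) dG = DegLt-partialSum D (Δ (0 , s) G) (dG (0 , s))
      translates : DegLt D (λ p → sumTo (λ i → G (p ⊕ (i , s))) c)
      translates = DegLt-sumTo D (λ i p → G (p ⊕ (i , s))) (λ i → DegLt-shift D (i , s) {G} dG) c

module NewtonInterpolation where
  open import Data.Nat as ℕ using (ℕ; zero; suc)
  open import Data.Rational using (ℚ; 0ℚ; 1ℚ; _+_; _*_; _-_)
  open import Data.Rational.Solver
  open +-*-Solver
  open import Relation.Binary.PropositionalEquality
  open NatEmbedding
  open FiniteDifferences
  open Differences ℕ-shifts

  binomial : ℕ → ℕ → ℕ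
  binomial n zero = 1
  binomial zero (suc k) = 0
  binomial (suc n) (suc k) = binomial n k ℕ.+ binomial n (suc k)

  iterΔ : ℕ → (ℕ → ℚ) → ℕ → ℚ
  iterΔ zero g = g
  iterΔ (suc i) g = iterΔ i (Δ 1 g)

  sumBelow : ℕ → (ℕ → ℚ) → ℚ
  sumBelow zero h = 0ℚ
  sumBelow (suc n) h = h 0 + sumBelow n (λ i → h (suc i))

  sumBelow-cong : ∀ n {h k} → (∀ i → h i ≡ k i) → sumBelow n h ≡ sumBelow n k
  sumBelow-cong zero e = refl
  sumBelow-cong (suc n) e = cong₂ _+_ (e 0) (sumBelow-cong n (λ i → e (suc i)))

  sumBelow-+ : ∀ n h k → sumBelow n (λ i → h i + k i) ≡ sumBelow n h + sumBelow n k
  sumBelow-+ zero h k = refl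
  sumBelow-+ (suc n) h k rewrite sumBelow-+ n (λ i → h (suc i)) (λ i → k (suc i)) =
    solve 4 (λ a b c d → a :+ b :+ (c :+ d) := a :+ c :+ (b :+ d)) refl
      (h 0) (k 0) (sumBelow n (λ i → h (suc i))) (sumBelow n (λ i → k (suc i)))

  sumBelow-zero : ∀ n h → (∀ i → h i ≡ 0ℚ) → sumBelow n h ≡ 0ℚ
  sumBelow-zero zero h z = refl
  sumBelow-zero (suc n) h z rewrite z 0 | sumBelow-zero n (λ i → h (suc i)) (λ i → z (suc i)) = refl

  newtonSeries : ℕ → (ℕ → ℚ) → ℕ → ℚ
  newtonSeries D g y = sumBelow (suc D) (λ i → toℚ (binomial y i) * iterΔ i g 0)

  private
    add-diff : ∀ a b → a + (b - a) ≡ b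
    add-diff = solve 2 (λ a b → a :+ (b :- a) := b) refl

  -- Pascal's rule lifts to the series: N_{D+1}(g)(y+1) = N_{D+1}(g)(y) + N_D(Δg)(y).
  newtonSeries-step : ∀ D g y → newtonSeries (suc D) g (suc y) ≡ newtonSeries (suc D) g y + newtonSeries D (Δ 1 g) y
  newtonSeries-step D g y = begin
    toℚ 1 * g 0 + sumBelow (suc D) (λ i → toℚ (binomial y i ℕ.+ binomial y (suc i)) * iterΔ i (Δ 1 g) 0)
      ≡⟨ cong (toℚ 1 * g 0 +_) (trans (sumBelow-cong (suc D) split) (sumBelow-+ (suc D) A B)) ⟩
    toℚ 1 * g 0 + (sumBelow (suc D) A + sumBelow (suc D) B)
      ≡⟨ solve 3 (λ x a b → x :+ (a :+ b) := x :+ b :+ a) refl (toℚ 1 * g 0) (sumBelow (suc D) A) (sumBelow (suc D) B) ⟩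
    toℚ 1 * g 0 + sumBelow (suc D) B + sumBelow (suc D) A ∎
    where
    open ≡-Reasoning
    A = λ i → toℚ (binomial y i) * iterΔ i (Δ 1 g) 0
    B = λ i → toℚ (binomial y (suc i)) * iterΔ i (Δ 1 g) 0
    split : ∀ i → toℚ (binomial y i ℕ.+ binomial y (suc i)) * iterΔ i (Δ 1 g) 0 ≡ A i + B i
    split i = trans (cong (_* iterΔ i (Δ 1 g) 0) (toℚ-+ (binomial y i) (binomial y (suc i))))
                    (solve 3 (λ a b x → (a :+ b) :* x := a :* x :+ b :* x) refl
                       (toℚ (binomial y i)) (toℚ (binomial y (suc i))) (iterΔ i (Δ 1 g) 0))

  newton-interpolation : ∀ D g → DegLt (suc D) g → ∀ y → g y ≡ newtonSeries D g y
  newton-interpolation zero g dg y = trans (constant y)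
    (trans (solve 1 (λ x → x := con 1ℚ :* x :+ con 0ℚ) refl (g 0)) (cong (λ z → z * g 0 + 0ℚ) (sym toℚ-1)))
    where
    constant : ∀ y → g y ≡ g 0
    constant zero = refl
    constant (suc y) = trans (sym (add-diff (g y) (g (suc y))))
      (trans (cong₂ _+_ (constant y) (dg 1 y)) (solve 1 (λ x → x :+ con 0ℚ := x) refl (g 0)))
  newton-interpolation (suc D) g dg zero = sym (trans (cong₂ _+_ (cong (_* g 0) toℚ-1) higher-terms)
                                                      (solve 1 (λ x → con 1ℚ :* x :+ con 0ℚ := x) refl (g 0)))
    where
    higher-terms : sumBelow (suc D) (λ i → toℚ (binomial 0 (suc i)) * iterΔ (suc i) g 0) ≡ 0ℚ
    higher-terms = sumBelow-zero (suc D) _ (λ i → trans (cong (_* iterΔ (suc i) g 0) toℚ-0)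
                                                         (solve 1 (λ x → con 0ℚ :* x := con 0ℚ) refl (iterΔ (suc i) g 0)))
  newton-interpolation (suc D) g dg (suc y) = begin
    g (suc y)                                          ≡⟨ sym (add-diff (g y) (g (suc y))) ⟩
    g y + Δ 1 g y                                      ≡⟨ cong₂ _+_ (newton-interpolation (suc D) g dg y)
                                                                     (newton-interpolation D (Δ 1 g) (dg 1) y) ⟩
    newtonSeries (suc D) g y + newtonSeries D (Δ 1 g) y ≡⟨ sym (newtonSeries-step D g y) ⟩
    newtonSeries (suc D) g (suc y)                     ∎
    where open ≡-Reasoning

-- The binomial
-- function y ↦ (y - 1 choose i) is a polynomial of degree i, so Newton's formula
-- produces an explicit polynomial with at most D + 1 coefficients.
module Polynomials where
  open import Data.Nat as ℕ using (ℕ; zero; suc; _≤_; _<_; z≤n; s≤s; _∸_)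
  import Data.Nat.Properties as ℕP
  open import Data.List using (List; []; _∷_; length; map)
  import Data.List.Properties as LP
  open import Data.Rational using (ℚ; 0ℚ; 1ℚ; _+_; _*_; _-_; -_; mkℚ; 1/_)
  import Data.Rational.Properties as ℚP
  open import Data.Rational.Solver
  open +-*-Solver
  open import Data.Product using (_×_; _,_; ∃)
  open import Relation.Binary.PropositionalEquality
  open import Data.Nat.Coprimality using (1-coprimeTo) renaming (sym to coprime-sym)
  open import Defs using (evalPoly)
  open NatEmbedding
  open FiniteDifferences
  open Differences ℕ-shifts
  open NewtonInterpolation

  binomial-absorption : ∀ y i → suc i ℕ.* binomial y (suc i) ℕ.+ i ℕ.* binomial y i ≡ y ℕ.* binomial y i
  binomial-absorption zero zero = refl
  binomial-absorption zero (suc i) = cong₂ ℕ._+_ (ℕP.*-zeroʳ (suc (suc i))) (ℕP.*-zeroʳ (suc i))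
  binomial-absorption (suc y) zero = cong suc (binomial-absorption y 0)
  binomial-absorption (suc y) (suc i) = begin
    (2 ℕ.+ i) ℕ.* (b₁ ℕ.+ b₂) ℕ.+ suc i ℕ.* (b₀ ℕ.+ b₁)
      ≡⟨ regroup i b₀ b₁ b₂ ⟩
    ((2 ℕ.+ i) ℕ.* b₂ ℕ.+ suc i ℕ.* b₁) ℕ.+ (suc i ℕ.* b₁ ℕ.+ i ℕ.* b₀) ℕ.+ b₀ ℕ.+ b₁
      ≡⟨ cong₂ (λ u v → u ℕ.+ v ℕ.+ b₀ ℕ.+ b₁) (binomial-absorption y (suc i)) (binomial-absorption y i) ⟩
    y ℕ.* b₁ ℕ.+ y ℕ.* b₀ ℕ.+ b₀ ℕ.+ b₁
      ≡⟨ collect y b₀ b₁ ⟩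
    suc y ℕ.* (b₀ ℕ.+ b₁) ∎
    where
    open ≡-Reasoning
    open import Data.Nat.Solver as NS using ()
    open NS.+-*-Solver renaming (solve to nsolve; _:=_ to _:=n_; _:+_ to _:+n_; _:*_ to _:*n_; con to ncon)
    b₀ = binomial y i
    b₁ = binomial y (suc i)
    b₂ = binomial y (suc (suc i))
    regroup : ∀ i b₀ b₁ b₂ → (2 ℕ.+ i) ℕ.* (b₁ ℕ.+ b₂) ℕ.+ suc i ℕ.* (b₀ ℕ.+ b₁) ≡
              ((2 ℕ.+ i) ℕ.* b₂ ℕ.+ suc i ℕ.* b₁) ℕ.+ (suc i ℕ.* b₁ ℕ.+ i ℕ.* b₀) ℕ.+ b₀ ℕ.+ b₁
    regroup = nsolve 4 (λ i b₀ b₁ b₂ →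
      (ncon 2 :+n i) :*n (b₁ :+n b₂) :+n (ncon 1 :+n i) :*n (b₀ :+n b₁) :=n
      ((ncon 2 :+n i) :*n b₂ :+n (ncon 1 :+n i) :*n b₁) :+n ((ncon 1 :+n i) :*n b₁ :+n i :*n b₀) :+n b₀ :+n b₁) refl
    collect : ∀ y b₀ b₁ → y ℕ.* b₁ ℕ.+ y ℕ.* b₀ ℕ.+ b₀ ℕ.+ b₁ ≡ suc y ℕ.* (b₀ ℕ.+ b₁)
    collect = nsolve 3 (λ y b₀ b₁ → y :*n b₁ :+n y :*n b₀ :+n b₀ :+n b₁ :=n (ncon 1 :+n y) :*n (b₀ :+n b₁)) refl

  binomial-ratio : ∀ y i → toℚ (suc i) * toℚ (binomial y (suc i)) ≡ (toℚ y - toℚ i) * toℚ (binomial y i)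
  binomial-ratio y i = begin
    a ≡⟨ solve 2 (λ a b → a := (a :+ b) :- b) refl a b ⟩
    (a + b) - b ≡⟨ cong (_- b) cast ⟩
    toℚ y * toℚ (binomial y i) - b
      ≡⟨ solve 3 (λ y i c → y :* c :- i :* c := (y :- i) :* c) refl (toℚ y) (toℚ i) (toℚ (binomial y i)) ⟩
    (toℚ y - toℚ i) * toℚ (binomial y i) ∎
    where
    open ≡-Reasoning
    a = toℚ (suc i) * toℚ (binomial y (suc i))
    b = toℚ i * toℚ (binomial y i)
    cast : a + b ≡ toℚ y * toℚ (binomial y i)
    cast = trans (sym (cong₂ _+_ (toℚ-* (suc i) _) (toℚ-* i _)))
                 (trans (sym (toℚ-+ _ _)) (trans (cong toℚ (binomial-absorption y i)) (toℚ-* y _)))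

  evalPoly-∷ : ∀ a p d → evalPoly (a ∷ p) d ≡ a + toℚ d * evalPoly p d
  evalPoly-∷ a p d = cong (λ z → a + z * evalPoly p d) (sym (toℚ-def d))

  addP : List ℚ → List ℚ → List ℚ
  addP [] q = q
  addP (a ∷ p) [] = a ∷ p
  addP (a ∷ p) (b ∷ q) = (a + b) ∷ addP p q

  evalPoly-addP : ∀ p q d → evalPoly (addP p q) d ≡ evalPoly p d + evalPoly q d
  evalPoly-addP [] q d = sym (solve 1 (λ x → con 0ℚ :+ x := x) refl (evalPoly q d))
  evalPoly-addP (a ∷ p) [] d = sym (solve 1 (λ x → x :+ con 0ℚ := x) refl (evalPoly (a ∷ p) d))
  evalPoly-addP (a ∷ p) (b ∷ q) d = begin
    evalPoly ((a + b) ∷ addP p q) d                  ≡⟨ evalPoly-∷ (a + b) (addP p q) d ⟩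
    (a + b) + toℚ d * evalPoly (addP p q) d          ≡⟨ cong (λ z → (a + b) + toℚ d * z) (evalPoly-addP p q d) ⟩
    (a + b) + toℚ d * (evalPoly p d + evalPoly q d)
      ≡⟨ solve 5 (λ a b x u w → (a :+ b) :+ x :* (u :+ w) := (a :+ x :* u) :+ (b :+ x :* w)) refl
           a b (toℚ d) (evalPoly p d) (evalPoly q d) ⟩
    (a + toℚ d * evalPoly p d) + (b + toℚ d * evalPoly q d) ≡⟨ sym (cong₂ _+_ (evalPoly-∷ a p d) (evalPoly-∷ b q d)) ⟩
    evalPoly (a ∷ p) d + evalPoly (b ∷ q) d          ∎
    where open ≡-Reasoning

  length-addP : ∀ p q L → length p ≤ L → length q ≤ L → length (addP p q) ≤ L
  length-addP [] q L lp lq = lq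
  length-addP (a ∷ p) [] L lp lq = lp
  length-addP (a ∷ p) (b ∷ q) (suc L) (s≤s lp) (s≤s lq) = s≤s (length-addP p q L lp lq)

  scaleP : ℚ → List ℚ → List ℚ
  scaleP a p = map (a *_) p

  evalPoly-scaleP : ∀ a p d → evalPoly (scaleP a p) d ≡ a * evalPoly p d
  evalPoly-scaleP a [] d = sym (solve 1 (λ x → x :* con 0ℚ := con 0ℚ) refl a)
  evalPoly-scaleP a (b ∷ p) d = begin
    evalPoly (a * b ∷ scaleP a p) d            ≡⟨ evalPoly-∷ (a * b) (scaleP a p) d ⟩
    a * b + toℚ d * evalPoly (scaleP a p) d    ≡⟨ cong (λ z → a * b + toℚ d * z) (evalPoly-scaleP a p d) ⟩
    a * b + toℚ d * (a * evalPoly p d)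
      ≡⟨ solve 4 (λ a b x e → a :* b :+ x :* (a :* e) := a :* (b :+ x :* e)) refl a b (toℚ d) (evalPoly p d) ⟩
    a * (b + toℚ d * evalPoly p d)             ≡⟨ cong (a *_) (sym (evalPoly-∷ b p d)) ⟩
    a * evalPoly (b ∷ p) d                     ∎
    where open ≡-Reasoning

  mulLinear : List ℚ → ℚ → ℚ → List ℚ
  mulLinear p α β = addP (scaleP α p) (0ℚ ∷ scaleP β p)

  evalPoly-mulLinear : ∀ p α β d → evalPoly (mulLinear p α β) d ≡ (α + β * toℚ d) * evalPoly p d
  evalPoly-mulLinear p α β d = begin
    evalPoly (mulLinear p α β) d                       ≡⟨ evalPoly-addP (scaleP α p) (0ℚ ∷ scaleP β p) d ⟩
    evalPoly (scaleP α p) d + evalPoly (0ℚ ∷ scaleP β p) d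
      ≡⟨ cong₂ _+_ (evalPoly-scaleP α p d)
                   (trans (evalPoly-∷ 0ℚ (scaleP β p) d) (cong (λ z → 0ℚ + toℚ d * z) (evalPoly-scaleP β p d))) ⟩
    α * evalPoly p d + (0ℚ + toℚ d * (β * evalPoly p d))
      ≡⟨ solve 4 (λ a b x e → a :* e :+ (con 0ℚ :+ x :* (b :* e)) := (a :+ b :* x) :* e) refl α β (toℚ d) (evalPoly p d) ⟩
    (α + β * toℚ d) * evalPoly p d                     ∎
    where open ≡-Reasoning

  length-mulLinear : ∀ p α β → length (mulLinear p α β) ≤ suc (length p)
  length-mulLinear p α β = length-addP (scaleP α p) (0ℚ ∷ scaleP β p) (suc (length p))
    (subst (_≤ suc (length p)) (sym (LP.length-map (α *_) p)) (ℕP.n≤1+n _))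
    (s≤s (ℕP.≤-reflexive (LP.length-map (β *_) p)))

  recipSuc : ℕ → ℚ
  recipSuc i = 1/ (mkℚ (ℤ.+ suc i) 0 (coprime-sym (1-coprimeTo (suc i))))
    where import Data.Integer as ℤ

  recipSuc-inverse : ∀ i → (1ℚ + toℚ i) * recipSuc i ≡ 1ℚ
  recipSuc-inverse i = trans (cong (_* recipSuc i) (trans (sym (toℚ-suc i)) (toℚ-canonical (suc i))))
                             (ℚP.*-inverseʳ (mkℚ (ℤ.+ suc i) 0 (coprime-sym (1-coprimeTo (suc i)))))
    where import Data.Integer as ℤ

  -- binomialPoly i is the polynomial x ↦ (x - 1 choose i) = Π_{j<i} (x - 1 - j)/(j + 1).
  binomialPoly : ℕ → List ℚ
  binomialPoly zero = 1ℚ ∷ []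
  binomialPoly (suc i) = mulLinear (binomialPoly i) (- 1ℚ) (recipSuc i)

  length-binomialPoly : ∀ i → length (binomialPoly i) ≤ suc i
  length-binomialPoly zero = s≤s z≤n
  length-binomialPoly (suc i) = ℕP.≤-trans (length-mulLinear (binomialPoly i) (- 1ℚ) (recipSuc i)) (s≤s (length-binomialPoly i))

  evalPoly-binomialPoly : ∀ i y → evalPoly (binomialPoly i) (suc y) ≡ toℚ (binomial y i)
  evalPoly-binomialPoly zero y = trans (evalPoly-∷ 1ℚ [] (suc y))
    (trans (solve 1 (λ x → con 1ℚ :+ x :* con 0ℚ := con 1ℚ) refl (toℚ (suc y))) (sym toℚ-1))
  evalPoly-binomialPoly (suc i) y = begin
    evalPoly (mulLinear (binomialPoly i) (- 1ℚ) r) (suc y)  ≡⟨ evalPoly-mulLinear (binomialPoly i) (- 1ℚ) r (suc y) ⟩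
    (- 1ℚ + r * toℚ (suc y)) * evalPoly (binomialPoly i) (suc y)
      ≡⟨ cong₂ (λ a b → (- 1ℚ + r * a) * b) (toℚ-suc y) (evalPoly-binomialPoly i y) ⟩
    (- 1ℚ + r * (1ℚ + toℚ y)) * B            ≡⟨ cong (λ z → (- z + r * (1ℚ + toℚ y)) * B) (sym (recipSuc-inverse i)) ⟩
    (- ((1ℚ + toℚ i) * r) + r * (1ℚ + toℚ y)) * B
      ≡⟨ solve 4 (λ ci cy v b → (:- ((con 1ℚ :+ ci) :* v) :+ v :* (con 1ℚ :+ cy)) :* b := v :* ((cy :- ci) :* b)) refl
           (toℚ i) (toℚ y) r B ⟩
    r * ((toℚ y - toℚ i) * B)                ≡⟨ cong (r *_) (sym (binomial-ratio y i)) ⟩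
    r * (toℚ (suc i) * X)                    ≡⟨ cong (λ z → r * (z * X)) (toℚ-suc i) ⟩
    r * ((1ℚ + toℚ i) * X)                   ≡⟨ solve 3 (λ v a x → v :* (a :* x) := (a :* v) :* x) refl r (1ℚ + toℚ i) X ⟩
    ((1ℚ + toℚ i) * r) * X                   ≡⟨ cong (_* X) (recipSuc-inverse i) ⟩
    1ℚ * X                                   ≡⟨ solve 1 (λ x → con 1ℚ :* x := x) refl X ⟩
    X                                        ∎
    where
    open ≡-Reasoning
    r = recipSuc i
    B = toℚ (binomial y i)
    X = toℚ (binomial y (suc i))

  combination : ℕ → (ℕ → ℚ) → (ℕ → List ℚ) → List ℚ
  combination zero a P = []
  combination (suc n) a P = addP (scaleP (a 0) (P 0)) (combination n (λ i → a (suc i)) (λ i → P (suc i)))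

  evalPoly-combination : ∀ n a P d → evalPoly (combination n a P) d ≡ sumBelow n (λ i → a i * evalPoly (P i) d)
  evalPoly-combination zero a P d = refl
  evalPoly-combination (suc n) a P d =
    trans (evalPoly-addP (scaleP (a 0) (P 0)) _ d) (cong₂ _+_ (evalPoly-scaleP (a 0) (P 0) d) (evalPoly-combination n _ _ d))

  length-combination : ∀ n a P L → (∀ i → i < n → length (P i) ≤ L) → length (combination n a P) ≤ L
  length-combination zero a P L h = z≤n
  length-combination (suc n) a P L h =
    length-addP (scaleP (a 0) (P 0)) _ L (subst (_≤ L) (sym (LP.length-map (a 0 *_) (P 0))) (h 0 (s≤s z≤n)))
      (length-combination n _ _ L (λ i i<n → h (suc i) (s≤s i<n)))

  polynomial-from-DegLt : ∀ D g → DegLt (suc D) g →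
    ∃ λ (cs : List ℚ) → length cs ≤ suc D × (∀ d → 1 ≤ d → g (d ∸ 1) ≡ evalPoly cs d)
  polynomial-from-DegLt D g dg = combination (suc D) coeff binomialPoly ,
    length-combination (suc D) coeff binomialPoly (suc D) (λ i i<n → ℕP.≤-trans (length-binomialPoly i) i<n) ,
    λ { (suc y) _ → trans (newton-interpolation D g dg y) (sym (trans (evalPoly-combination (suc D) coeff binomialPoly (suc y))
          (sumBelow-cong (suc D) (λ i → trans (cong (coeff i *_) (evalPoly-binomialPoly i y))
                                              (solve 2 (λ a b → a :* b := b :* a) refl (coeff i) (toℚ (binomial y i))))))) }
    where
    coeff : ℕ → ℚ
    coeff i = iterΔ i g 0

-- Independent vectors: m ∈ ℕ^v with no two adjacent nonzero entries.  `independentBelow v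
-- b as` lists those m ≤ as (entrywise) whose first entry is 0 when b ("blocked") holds.
module IndependentVectors where
  open import Data.Nat as ℕ using (ℕ; zero; suc; _+_; _*_; _⊔_; _≤_; z≤n; s≤s)
  open import Data.Nat.Properties
  open import Data.Bool using (Bool; true; false)
  open import Data.List using (List; []; _∷_; _++_; map; [_]; concatMap)
  import Data.List.Properties as LP
  open import Data.Vec using (Vec; []; _∷_; tail)
  import Data.Vec.Properties as VP
  open import Data.List.Membership.Propositional using (_∈_)
  open import Data.List.Membership.Propositional.Properties using (∈-map⁺; ∈-map⁻; ∈-++⁺ˡ; ∈-++⁺ʳ; ∈-++⁻)
  open import Data.List.Relation.Unary.Any using (here; there)
  open import Data.List.Relation.Unary.Unique.Propositional using (Unique)
  open import Data.List.Relation.Unary.AllPairs using ([]; _∷_)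
  open import Data.List.Relation.Unary.All using ([])
  import Data.List.Relation.Unary.Unique.Propositional.Properties as UP
  open import Data.Rational using (ℚ; 0ℚ) renaming (_+_ to _+ℚ_)
  open import Data.Rational.Solver
  open +-*-Solver
  open import Data.Product using (_×_; _,_; proj₁; proj₂; ∃)
  open import Data.Sum using (_⊎_; inj₁; inj₂)
  open import Relation.Nullary using (¬_)
  open import Relation.Binary.PropositionalEquality hiding ([_])
  open NatEmbedding using (sumℚ)
  open FiniteDifferences
  open DegreeLemmas using (partialSum; DegLt-partialSum)

  oneTo : ℕ → List ℕ
  oneTo zero = []
  oneTo (suc a) = oneTo a ++ [ suc a ]

  independentBelow : (v : ℕ) → Bool → Vec ℕ v → List (Vec ℕ v)
  independentBelow zero b [] = [] ∷ []
  independentBelow (suc v) true (a ∷ as) = map (0 ∷_) (independentBelow v false as)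
  independentBelow (suc v) false (a ∷ as) =
    map (0 ∷_) (independentBelow v false as) ++ concatMap (λ j → map (j ∷_) (independentBelow v true as)) (oneTo a)

  -- The largest number of nonzero entries of a vector in `independentBelow v b as`.
  maxSupport : ℕ → Bool → ℕ
  maxSupport zero b = 0
  maxSupport (suc v) true = maxSupport v false
  maxSupport (suc v) false = maxSupport v false ⊔ suc (maxSupport v true)

  maxSupport-half : ∀ v → maxSupport v true * 2 ≤ v × maxSupport v false * 2 ≤ suc v
  maxSupport-half zero = z≤n , z≤n
  maxSupport-half (suc v) = let (t , f) = maxSupport-half v in
    f , subst (_≤ suc (suc v)) (sym (*-distribʳ-⊔ 2 (maxSupport v false) (suc (maxSupport v true))))
          (⊔-lub (m≤n⇒m≤1+n f) (s≤s (s≤s t)))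

  maxSupport≤half : ∀ v → maxSupport v false ≤ suc v ℕ./ 2
  maxSupport≤half v = subst (_≤ suc v ℕ./ 2) (m*n/n≡m (maxSupport v false) 2) (/-monoˡ-≤ 2 (proj₂ (maxSupport-half v)))
    where open import Data.Nat.DivMod using (m*n/n≡m; /-monoˡ-≤)

  withVec : ∀ {Y} → Shifts Y → ∀ v → Shifts (Y × Vec ℕ v)
  withVec SY v = ×-shifts SY (Vec-shifts v)

  sumIndependent : ∀ {Y : Set} v → Bool → (Y × Vec ℕ v → ℚ) → Y × Vec ℕ v → ℚ
  sumIndependent v b f (y , as) = sumℚ (map (λ m → f (y , m)) (independentBelow v b as))

  private
    sumℚ-++ : ∀ xs ys → sumℚ (xs ++ ys) ≡ sumℚ xs +ℚ sumℚ ys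
    sumℚ-++ [] ys = sym (solve 1 (λ x → con 0ℚ :+ x := x) refl (sumℚ ys))
    sumℚ-++ (x ∷ xs) ys rewrite sumℚ-++ xs ys = solve 3 (λ x y z → x :+ (y :+ z) := x :+ y :+ z) refl x (sumℚ xs) (sumℚ ys)

    sumℚ-concatMap-oneTo : ∀ {A : Set} (g : A → ℚ) (h : ℕ → List A) a →
      sumℚ (map g (concatMap h (oneTo a))) ≡ sumTo (λ j → sumℚ (map g (h j))) a
    sumℚ-concatMap-oneTo g h zero = refl
    sumℚ-concatMap-oneTo g h (suc a) = begin
      sumℚ (map g (concatMap h (oneTo a ++ [ suc a ])))  ≡⟨ cong (λ z → sumℚ (map g z)) (LP.concatMap-++ h (oneTo a) [ suc a ]) ⟩
      sumℚ (map g (concatMap h (oneTo a) ++ (h (suc a) ++ []))) ≡⟨ cong sumℚ (LP.map-++ g (concatMap h (oneTo a)) _) ⟩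
      sumℚ (map g (concatMap h (oneTo a)) ++ map g (h (suc a) ++ [])) ≡⟨ sumℚ-++ (map g (concatMap h (oneTo a))) _ ⟩
      sumℚ (map g (concatMap h (oneTo a))) +ℚ sumℚ (map g (h (suc a) ++ []))
        ≡⟨ cong₂ _+ℚ_ (sumℚ-concatMap-oneTo g h a) (cong (λ z → sumℚ (map g z)) (LP.++-identityʳ (h (suc a)))) ⟩
      sumTo (λ j → sumℚ (map g (h j))) a +ℚ sumℚ (map g (h (suc a))) ∎
      where open ≡-Reasoning

  withHead : ∀ {Y : Set} {v} → ℕ → (Y × Vec ℕ (suc v) → ℚ) → Y × Vec ℕ v → ℚ
  withHead j f (y , m) = f (y , j ∷ m)

  sumIndependent-blocked : ∀ {Y : Set} v f (y : Y) a as →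
    sumIndependent (suc v) true f (y , a ∷ as) ≡ sumIndependent v false (withHead 0 f) (y , as)
  sumIndependent-blocked v f y a as = cong sumℚ (sym (LP.map-∘ (independentBelow v false as)))

  sumIndependent-free : ∀ {Y : Set} v f (y : Y) a as →
    sumIndependent (suc v) false f (y , a ∷ as) ≡ sumIndependent v false (withHead 0 f) (y , as) +ℚ
      sumTo (λ j → sumIndependent v true (withHead j f) (y , as)) a
  sumIndependent-free v f y a as = begin
    sumℚ (map g (map (0 ∷_) (independentBelow v false as) ++ concatMap h (oneTo a)))
      ≡⟨ cong sumℚ (LP.map-++ g (map (0 ∷_) (independentBelow v false as)) _) ⟩
    sumℚ (map g (map (0 ∷_) (independentBelow v false as)) ++ map g (concatMap h (oneTo a)))
      ≡⟨ sumℚ-++ (map g (map (0 ∷_) (independentBelow v false as))) _ ⟩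
    _ ≡⟨ cong₂ _+ℚ_ (cong sumℚ (sym (LP.map-∘ (independentBelow v false as))))
                   (trans (sumℚ-concatMap-oneTo g h a) (sumTo-cong a)) ⟩
    _ ∎
    where
    open ≡-Reasoning
    g = λ m → f (y , m)
    h = λ j → map (j ∷_) (independentBelow v true as)
    sumTo-cong : ∀ k → sumTo (λ j → sumℚ (map g (h j))) k ≡
                       sumTo (λ j → sumIndependent v true (withHead j f) (y , as)) k
    sumTo-cong zero = refl
    sumTo-cong (suc k) = cong₂ _+ℚ_ (sumTo-cong k) (cong sumℚ (sym (LP.map-∘ (independentBelow v true as))))

  DegLt-withHead : ∀ {Y} (SY : Shifts Y) v D j f → Differences.DegLt (withVec SY (suc v)) D f →
                   Differences.DegLt (withVec SY v) D (withHead j f)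
  DegLt-withHead SY v D j f = DegLt-pull (withVec SY v) (withVec SY (suc v)) D
    (λ { (y , m) → (y , j ∷ m) }) (λ { (t , s) → (t , 0 ∷ s) }) (λ x s → refl)

  dropHead : ∀ {Y : Set} {v} → Y × Vec ℕ (suc v) → Y × Vec ℕ v
  dropHead (y , m) = (y , tail m)

  DegLt-dropHead : ∀ {Y} (SY : Shifts Y) v D F → Differences.DegLt (withVec SY v) D F →
                   Differences.DegLt (withVec SY (suc v)) D (λ p → F (dropHead p))
  DegLt-dropHead SY v D F = DegLt-pull (withVec SY (suc v)) (withVec SY v) D dropHead dropHead
    (λ { (y , a ∷ as) (t , b ∷ bs) → refl })

  DegLt-sumIndependent : ∀ v b {Y : Set} (SY : Shifts Y) D f → Differences.DegLt (withVec SY v) D f →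
                         Differences.DegLt (withVec SY v) (D + maxSupport v b) (sumIndependent v b f)
  DegLt-sumIndependent zero b SY D f df =
    subst (λ k → Differences.DegLt (withVec SY 0) k (sumIndependent 0 b f)) (sym (+-identityʳ D))
      (Differences.DegLt-cong (withVec SY 0) D (λ { (y , []) → sym (solve 1 (λ x → x :+ con 0ℚ := x) refl (f (y , []))) }) df)
  DegLt-sumIndependent (suc v) true SY D f df =
    Differences.DegLt-cong (withVec SY (suc v)) (D + maxSupport v false)
      (λ { (y , a ∷ as) → sym (sumIndependent-blocked v f y a as) })
      (DegLt-dropHead SY v (D + maxSupport v false) (sumIndependent v false (withHead 0 f))
        (DegLt-sumIndependent v false SY D (withHead 0 f) (DegLt-withHead SY v D 0 f df)))
  DegLt-sumIndependent (suc v) false {Y} SY D f df =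
    Differences.DegLt-cong (withVec SY (suc v)) (D + maxSupport (suc v) false)
      (λ { (y , a ∷ as) → sym (sumIndependent-free v f y a as) })
      (Differences.DegLt-+ (withVec SY (suc v)) (D + maxSupport (suc v) false)
        {λ p → sumIndependent v false (withHead 0 f) (dropHead p)} {λ p → partialSum (withVec SY v) H (splitHead p)}
        (Differences.DegLt-≤ (withVec SY (suc v)) (+-monoʳ-≤ D (m≤m⊔n (maxSupport v false) (suc (maxSupport v true))))
           (DegLt-dropHead SY v (D + maxSupport v false) (sumIndependent v false (withHead 0 f))
             (DegLt-sumIndependent v false SY D (withHead 0 f) (DegLt-withHead SY v D 0 f df))))
        (Differences.DegLt-≤ (withVec SY (suc v))
           (subst (_≤ D + maxSupport (suc v) false) (+-suc D (maxSupport v true))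
                  (+-monoʳ-≤ D (m≤n⊔m (maxSupport v false) (suc (maxSupport v true)))))
           nonzeroHeadSum))
    where
    -- The terms with nonzero head j: the head becomes a summation variable of the parameter.
    f₁ : (ℕ × Y) × Vec ℕ v → ℚ
    f₁ ((j , y) , m) = f (y , j ∷ m)
    H : ℕ × (Y × Vec ℕ v) → ℚ
    H (j , (y , as)) = sumIndependent v true f₁ ((j , y) , as)
    splitHead : Y × Vec ℕ (suc v) → ℕ × (Y × Vec ℕ v)
    splitHead (y , a ∷ as) = (a , (y , as))
    DegLt-H : Differences.DegLt (×-shifts ℕ-shifts (withVec SY v)) (D + maxSupport v true) H
    DegLt-H = DegLt-pull (×-shifts ℕ-shifts (withVec SY v)) (withVec (×-shifts ℕ-shifts SY) v) (D + maxSupport v true)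
                (λ { (j , (y , as)) → ((j , y) , as) }) (λ { (j , (y , as)) → ((j , y) , as) }) (λ x s → refl)
                (DegLt-sumIndependent v true (×-shifts ℕ-shifts SY) D f₁
                   (DegLt-pull (withVec (×-shifts ℕ-shifts SY) v) (withVec SY (suc v)) D
                      (λ { ((j , y) , m) → (y , j ∷ m) }) (λ { ((j , y) , m) → (y , j ∷ m) }) (λ x s → refl) df))
    nonzeroHeadSum : Differences.DegLt (withVec SY (suc v)) (suc (D + maxSupport v true))
                                       (λ p → partialSum (withVec SY v) H (splitHead p))
    nonzeroHeadSum = DegLt-pull (withVec SY (suc v)) (×-shifts ℕ-shifts (withVec SY v)) (suc (D + maxSupport v true))
                       splitHead splitHead (λ { (y , a ∷ as) (t , b ∷ bs) → refl }) {partialSum (withVec SY v) H}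
                       (DegLt-partialSum (withVec SY v) (D + maxSupport v true) H DegLt-H)

  -- Total lookup: entry m k is the k-th entry of m, and 0 beyond its length.
  entry : ∀ {w} → Vec ℕ w → ℕ → ℕ
  entry [] k = 0
  entry (a ∷ as) zero = a
  entry (a ∷ as) (suc k) = entry as k

  NoAdjacent : ∀ {w} → Vec ℕ w → Set
  NoAdjacent m = ∀ k → entry m k ≡ 0 ⊎ entry m (suc k) ≡ 0

  IndependentBelow : ∀ {w} → Bool → Vec ℕ w → Vec ℕ w → Set
  IndependentBelow b as m = (∀ k → entry m k ≤ entry as k) × NoAdjacent m × (b ≡ true → entry m 0 ≡ 0)

  private
    ∈-oneTo⁻ : ∀ {j} a → j ∈ oneTo a → 1 ≤ j × j ≤ a
    ∈-oneTo⁻ (suc a) m with ∈-++⁻ (oneTo a) m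
    ... | inj₁ m₁ = let (p , q) = ∈-oneTo⁻ a m₁ in p , m≤n⇒m≤1+n q
    ... | inj₂ (here refl) = s≤s z≤n , ≤-refl

    ∈-oneTo⁺ : ∀ {j} a → 1 ≤ j → j ≤ a → j ∈ oneTo a
    ∈-oneTo⁺ {j} (suc a) p q with m≤n⇒m<n∨m≡n q
    ... | inj₁ (s≤s lt) = ∈-++⁺ˡ (∈-oneTo⁺ a p lt)
    ... | inj₂ refl = ∈-++⁺ʳ (oneTo a) (here refl)
    ∈-oneTo⁺ {suc j} zero p ()

    ∈-concatMap⁻ : ∀ {A B : Set} (f : A → List B) xs {z} → z ∈ concatMap f xs → ∃ λ x → x ∈ xs × z ∈ f x
    ∈-concatMap⁻ f (x ∷ xs) m with ∈-++⁻ (f x) m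
    ... | inj₁ m₁ = x , here refl , m₁
    ... | inj₂ m₂ = let (y , ym , zm) = ∈-concatMap⁻ f xs m₂ in y , there ym , zm

    ∈-concatMap⁺ : ∀ {A B : Set} (f : A → List B) {xs x z} → x ∈ xs → z ∈ f x → z ∈ concatMap f xs
    ∈-concatMap⁺ f {x ∷ xs} (here refl) zm = ∈-++⁺ˡ zm
    ∈-concatMap⁺ f {x ∷ xs} (there m) zm = ∈-++⁺ʳ (f x) (∈-concatMap⁺ f m zm)

    ∈-map-∷⁻ : ∀ {w} {j : ℕ} {L : List (Vec ℕ w)} {z} → z ∈ map (j ∷_) L → ∃ λ m → m ∈ L × z ≡ j ∷ m
    ∈-map-∷⁻ m = ∈-map⁻ _ m

    unique-map-∷ : ∀ {w} (j : ℕ) (L : List (Vec ℕ w)) → Unique L → Unique (map (j ∷_) L)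
    unique-map-∷ j L u = UP.map⁺ VP.∷-injectiveʳ u

  independentBelow-sound : ∀ w b (as : Vec ℕ w) m → m ∈ independentBelow w b as → IndependentBelow b as m
  independentBelow-sound zero b [] [] _ = (λ k → z≤n) , (λ k → inj₁ refl) , (λ _ → refl)
  independentBelow-sound (suc w) true (a ∷ as) m mm with ∈-map-∷⁻ mm
  ... | m' , m'm , refl = let (b₁ , b₂ , b₃) = independentBelow-sound w false as m' m'm in
    (λ { zero → z≤n ; (suc k) → b₁ k }) , (λ { zero → inj₁ refl ; (suc k) → b₂ k }) , (λ _ → refl)
  independentBelow-sound (suc w) false (a ∷ as) m mm with ∈-++⁻ (map (0 ∷_) (independentBelow w false as)) mm
  ... | inj₁ m₁ with ∈-map-∷⁻ m₁
  ... | m' , m'm , refl = let (b₁ , b₂ , b₃) = independentBelow-sound w false as m' m'm in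
    (λ { zero → z≤n ; (suc k) → b₁ k }) , (λ { zero → inj₁ refl ; (suc k) → b₂ k }) , (λ ())
  independentBelow-sound (suc w) false (a ∷ as) m mm | inj₂ m₂
    with ∈-concatMap⁻ (λ j → map (j ∷_) (independentBelow w true as)) (oneTo a) m₂
  ... | j , jm , zm with ∈-map-∷⁻ zm
  ... | m' , m'm , refl = let (b₁ , b₂ , b₃) = independentBelow-sound w true as m' m'm in
    (λ { zero → proj₂ (∈-oneTo⁻ a jm) ; (suc k) → b₁ k }) , (λ { zero → inj₂ (b₃ refl) ; (suc k) → b₂ k }) , (λ ())

  independentBelow-complete : ∀ w b (as : Vec ℕ w) m → IndependentBelow b as m → m ∈ independentBelow w b as
  independentBelow-complete zero b [] [] _ = here refl
  independentBelow-complete (suc w) true (a ∷ as) (x ∷ m) (b₁ , b₂ , b₃) with b₃ refl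
  ... | refl = ∈-map⁺ (0 ∷_) (independentBelow-complete w false as m ((λ k → b₁ (suc k)) , (λ k → b₂ (suc k)) , (λ ())))
  independentBelow-complete (suc w) false (a ∷ as) (zero ∷ m) (b₁ , b₂ , b₃) =
    ∈-++⁺ˡ (∈-map⁺ (0 ∷_) (independentBelow-complete w false as m ((λ k → b₁ (suc k)) , (λ k → b₂ (suc k)) , (λ ()))))
  independentBelow-complete (suc w) false (a ∷ as) (suc x ∷ m) (b₁ , b₂ , b₃) =
    ∈-++⁺ʳ (map (0 ∷_) (independentBelow w false as))
      (∈-concatMap⁺ (λ j → map (j ∷_) (independentBelow w true as)) (∈-oneTo⁺ a (s≤s z≤n) (b₁ 0))
        (∈-map⁺ (suc x ∷_) (independentBelow-complete w true as m ((λ k → b₁ (suc k)) , (λ k → b₂ (suc k)) , (λ _ → head0)))))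
    where
    head0 : entry m 0 ≡ 0
    head0 with b₂ 0
    ... | inj₁ ()
    ... | inj₂ e = e

  independentBelow-unique : ∀ w b (as : Vec ℕ w) → Unique (independentBelow w b as)
  independentBelow-unique zero b [] = [] ∷ []
  independentBelow-unique (suc w) true (a ∷ as) = unique-map-∷ 0 _ (independentBelow-unique w false as)
  independentBelow-unique (suc w) false (a ∷ as) =
    UP.++⁺ (unique-map-∷ 0 _ (independentBelow-unique w false as)) (unique-heads a) disjoint
    where
    h = λ j → map (j ∷_) (independentBelow w true as)
    head-of : ∀ {j : ℕ} {L : List (Vec ℕ w)} {z} → z ∈ map (j ∷_) L → Data.Vec.head z ≡ j
    head-of m with ∈-map-∷⁻ m
    ... | _ , _ , refl = refl
    unique-heads : ∀ a → Unique (concatMap h (oneTo a))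
    unique-heads zero = []
    unique-heads (suc a) = subst Unique (sym (LP.concatMap-++ h (oneTo a) [ suc a ]))
      (UP.++⁺ (unique-heads a) (subst Unique (sym (LP.++-identityʳ _)) (unique-map-∷ (suc a) _ (independentBelow-unique w true as))) apart)
      where
      apart : ∀ {z} → ¬ (z ∈ concatMap h (oneTo a) × z ∈ concatMap h [ suc a ])
      apart (m₁ , m₂) with ∈-concatMap⁻ h (oneTo a) m₁ | ∈-concatMap⁻ h [ suc a ] m₂
      ... | j , jm , zm | j' , here refl , zm' =
        1+n≰n (subst (_≤ a) (trans (sym (head-of zm)) (head-of zm')) (proj₂ (∈-oneTo⁻ a jm)))
    disjoint : ∀ {z} → ¬ (z ∈ map (0 ∷_) (independentBelow w false as) × z ∈ concatMap h (oneTo a))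
    disjoint (m₁ , m₂) with ∈-concatMap⁻ h (oneTo a) m₂
    ... | j , jm , zm with trans (sym (head-of m₁)) (head-of zm) | proj₁ (∈-oneTo⁻ a jm)
    ... | refl | ()

module BetaSets where
  open import Data.Nat using (ℕ; suc; _+_; _∸_; _≤_; _<_; _>_; s≤s; _<?_)
  open import Data.Nat.Properties
  open import Data.List using (List; []; _∷_; _++_; map; length; zip; applyUpTo; concat)
  import Data.List.Properties as LP
  open import Data.Nat.ListAction using (sum)
  open import Data.List.Relation.Unary.All using (All; []; _∷_)
  import Data.List.Relation.Unary.All as All
  import Data.List.Relation.Unary.All.Properties as AllP
  open import Data.List.Relation.Unary.Linked as Linked using (Linked; []; [-]; _∷_)
  open import Data.List.Relation.Unary.Linked.Properties using (Linked⇒All)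
  open import Data.List.Relation.Unary.Unique.Propositional using (Unique)
  open import Data.List.Relation.Unary.AllPairs using ([]; _∷_)
  open import Data.List.Membership.Propositional using (_∈_; _∉_)
  open import Data.List.Membership.Propositional.Properties
    using (∈-map⁺; ∈-map⁻; ∈-upTo⁺; ∈-upTo⁻; ∈-++⁺ˡ; ∈-++⁺ʳ; ∈-++⁻; ∈-∃++)
  open import Data.List.Relation.Unary.Any using (here; there)
  open import Data.List.Relation.Binary.Permutation.Propositional using (_↭_; ↭-refl; ↭-sym; ↭-trans; prep)
  import Data.List.Relation.Binary.Permutation.Propositional.Properties as PermP
  open import Data.Product using (_×_; _,_; proj₁; proj₂; ∃)
  open import Data.Sum using (inj₁; inj₂)
  open import Data.Empty using (⊥-elim; ⊥)
  open import Relation.Nullary using (¬_; yes; no)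
  open import Relation.Binary.PropositionalEquality
  open import Relation.Binary.Definitions using (tri<; tri≈; tri>)
  open import Function using (_∘_)
  open import Defs
  open DegreeLemmas using (choose2)

  betaSet : List ℕ → List ℕ
  betaSet [] = []
  betaSet (p ∷ ps) = (p + length ps) ∷ betaSet ps

  below-head : ∀ {x xs} → Linked _>_ (x ∷ xs) → All (_< x) xs
  below-head [-] = []
  below-head (r ∷ l) = Linked⇒All (λ a>b b>c → <-trans b>c a>b) r l

  length-betaSet : ∀ xs → length (betaSet xs) ≡ length xs
  length-betaSet [] = refl
  length-betaSet (b ∷ bs) = cong suc (length-betaSet bs)

  colLen-∷-< : ∀ j p rest → j < p → colLen j (p ∷ rest) ≡ suc (colLen j rest)
  colLen-∷-< j p rest j<p = cong length (LP.filter-accept (j <?_) {x = p} {xs = rest} j<p)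

  colLen-beyond : ∀ j rest → All (_≤ j) rest → colLen j rest ≡ 0
  colLen-beyond j [] _ = refl
  colLen-beyond j (q ∷ rest) (q≤j ∷ a) =
    trans (cong length (LP.filter-reject (j <?_) {x = q} {xs = rest} (λ j<q → <⇒≱ j<q q≤j))) (colLen-beyond j rest a)

  colLen-≤ : ∀ j rest → colLen j rest ≤ length rest
  colLen-≤ j rest = LP.length-filter (j <?_) rest

  -- Adding a longer first row does not change the hooks of the other rows, so the
  -- hooks of p ∷ rest are those of the first row followed by those of rest.
  rowHooks-∷ : ∀ p rest i q → q ≤ p → rowHooks (p ∷ rest) (suc i) q ≡ rowHooks rest i q
  rowHooks-∷ p rest i q q≤p = LP.map-cong-local (All.tabulate (λ {j} jm →
    cong (λ z → (q ∸ j ∸ 1) + (z ∸ suc i ∸ 1) + 1) (colLen-∷-< j p rest (<-≤-trans (∈-upTo⁻ jm) q≤p))))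

  hooks-∷ : ∀ p rest → All (_≤ p) rest → hooks (p ∷ rest) ≡ rowHooks (p ∷ rest) 0 p ++ hooks rest
  hooks-∷ p rest a = cong (λ z → rowHooks (p ∷ rest) 0 p ++ concat z) (rows (λ x → x) rest a)
    where
    rowsOf : List ℕ → ℕ × ℕ → List ℕ
    rowsOf Λ (i , q) = rowHooks Λ i q
    rows : ∀ (f : ℕ → ℕ) xs → All (_≤ p) xs →
      map (rowsOf (p ∷ rest)) (zip (applyUpTo (suc ∘ f) (length xs)) xs) ≡ map (rowsOf rest) (zip (applyUpTo f (length xs)) xs)
    rows f [] a = refl
    rows f (q ∷ qs) (q≤p ∷ a) = cong₂ _∷_ (rowHooks-∷ p rest (f 0) q q≤p) (rows (f ∘ suc) qs a)

  betaSet-bound : ∀ q xs → All (_< q) xs → All (_< q + length xs) (betaSet xs)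
  betaSet-bound q [] a = []
  betaSet-bound q (r ∷ rs) (r<q ∷ a) =
    +-mono-<-≤ r<q (n≤1+n _) ∷ All.map (λ z< → <-≤-trans z< (+-monoʳ-≤ q (n≤1+n _))) (betaSet-bound q rs a)

  -- For a new first row p on top of `rest`, column j < p of that row corresponds to the
  -- position gapOf rest j = j + ℓ - λ'_j, which is a gap (non-element) of β(rest) below
  -- p + ℓ; and every such gap arises this way.
  gapOf : List ℕ → ℕ → ℕ
  gapOf rest j = j + length rest ∸ colLen j rest

  private
    ∉-∷ : ∀ {x y : ℕ} {ys} → x ≢ y → x ∉ ys → x ∉ (y ∷ ys)
    ∉-∷ ne n (here e) = ne e
    ∉-∷ ne n (there m) = n m

    All-∉ : ∀ {x} {ys : List ℕ} {P : ℕ → Set} → All P ys → ¬ P x → x ∉ ys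
    All-∉ (px ∷ a) ¬p (here refl) = ¬p px
    All-∉ (px ∷ a) ¬p (there m) = All-∉ a ¬p m

    gapOf-< : ∀ q rest j → j < q → gapOf (q ∷ rest) j ≡ gapOf rest j
    gapOf-< q rest j j<q rewrite colLen-∷-< j q rest j<q | +-suc j (length rest) = refl

    gapOf-≥ : ∀ q rest j → All (_< q) rest → q ≤ j → gapOf (q ∷ rest) j ≡ j + suc (length rest)
    gapOf-≥ q rest j a q≤j rewrite colLen-beyond j (q ∷ rest) (q≤j ∷ All.map (λ z<q → <⇒≤ (<-≤-trans z<q q≤j)) a) = refl

  gapOf-gap : ∀ rest p → Linked _>_ rest → All (_< p) rest → ∀ j → j < p →
              gapOf rest j < p + length rest × gapOf rest j ∉ betaSet rest
  gapOf-gap [] p _ _ j j<p = +-monoˡ-< 0 j<p , λ ()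
  gapOf-gap (q ∷ rest) p L (q<p ∷ a) j j<p with j <? q
  ... | yes j<q =
    let (bound , gap) = gapOf-gap rest q (Linked.tail L) (below-head L) j j<q
        e = gapOf-< q rest j j<q
    in subst (_< p + suc (length rest)) (sym e) (<-trans bound (+-mono-< q<p (n<1+n _))) ,
       subst (_∉ betaSet (q ∷ rest)) (sym e) (∉-∷ (<⇒≢ bound) gap)
  ... | no j≮q =
    let e = gapOf-≥ q rest j (below-head L) (≮⇒≥ j≮q)
        above : q + length rest < j + suc (length rest)
        above = subst (q + length rest <_) (sym (+-suc j (length rest))) (s≤s (+-monoˡ-≤ _ (≮⇒≥ j≮q)))
    in subst (_< p + suc (length rest)) (sym e) (+-monoˡ-< _ j<p) ,
       subst (_∉ betaSet (q ∷ rest)) (sym e)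
         (∉-∷ (λ eq → <⇒≢ above (sym eq)) (All-∉ (betaSet-bound q rest (below-head L)) (λ lt → <-asym lt above)))

  gapOf-onto : ∀ rest p → Linked _>_ rest → All (_< p) rest → ∀ x → x < p + length rest → x ∉ betaSet rest →
               ∃ λ j → j < p × x ≡ gapOf rest j
  gapOf-onto [] p _ _ x x< _ = x , subst (_< p) (+-identityʳ x) (subst (x + 0 <_) (+-identityʳ p)
                                     (subst (_< p + 0) (sym (+-identityʳ x)) x<)) , sym (+-identityʳ x)
  gapOf-onto (q ∷ rest) p L (q<p ∷ a) x x< x∉ with <-cmp x (q + length rest)
  ... | tri< lt _ _ =
    let (j , j<q , e) = gapOf-onto rest q (Linked.tail L) (below-head L) x lt (λ m → x∉ (there m))
    in j , <-trans j<q q<p , trans e (sym (gapOf-< q rest j j<q))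
  ... | tri≈ _ eq _ = ⊥-elim (x∉ (here eq))
  ... | tri> _ _ gt = j , j<p , sym (trans (gapOf-≥ q rest j (below-head L) q≤j) (m∸n+n≡m ℓ≤x))
    where
    ℓ = suc (length rest)
    j = x ∸ ℓ
    ℓ≤x : ℓ ≤ x
    ℓ≤x = ≤-trans (s≤s (m≤n+m (length rest) q)) gt
    q≤j : q ≤ j
    q≤j = ≤-trans (≤-reflexive (sym (m+n∸n≡m q ℓ))) (∸-monoˡ-≤ ℓ (subst (_≤ x) (sym (+-suc q (length rest))) gt))
    j<p : j < p
    j<p = +-cancelʳ-< ℓ j p (subst (_< p + ℓ) (sym (m∸n+n≡m ℓ≤x)) x<)

  firstRow-hook : ∀ p rest j → j < p →
    (p ∸ j ∸ 1) + (colLen j (p ∷ rest) ∸ 0 ∸ 1) + 1 ≡ (p + length rest) ∸ gapOf rest j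
  firstRow-hook p rest j j<p = trans (cong (λ z → (p ∸ j ∸ 1) + (z ∸ 0 ∸ 1) + 1) (colLen-∷-< j p rest j<p))
                                     (arith p j (colLen j rest) (length rest) j<p (colLen-≤ j rest))
    where
    arith : ∀ p j col ℓ → j < p → col ≤ ℓ → (p ∸ j ∸ 1) + col + 1 ≡ (p + ℓ) ∸ (j + ℓ ∸ col)
    arith p j col ℓ j<p col≤ℓ with m≤n⇒∃[o]m+o≡n j<p | m≤n⇒∃[o]m+o≡n col≤ℓ
    ... | e , refl | f , refl = begin
      (suc (j + e) ∸ j ∸ 1) + col + 1
        ≡⟨ cong (λ z → z ∸ 1 + col + 1) (trans (cong (_∸ j) (cong suc (+-comm j e))) (m+n∸n≡m (suc e) j)) ⟩
      e + col + 1                      ≡⟨ solve 2 (λ e c → e :+ c :+ con 1 := con 1 :+ e :+ c) refl e col ⟩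
      suc e + col                      ≡⟨ sym (m+n∸n≡m (suc e + col) (j + f)) ⟩
      (suc e + col + (j + f)) ∸ (j + f)
        ≡⟨ cong₂ _∸_ (solve 4 (λ e c j f → con 1 :+ e :+ c :+ (j :+ f) := con 1 :+ (j :+ e) :+ (c :+ f)) refl e col j f)
                     (sym (trans (cong (_∸ col) (solve 3 (λ j c f → j :+ (c :+ f) := j :+ f :+ c) refl j col f)) (m+n∸n≡m (j + f) col))) ⟩
      (suc (j + e) + (col + f)) ∸ (j + (col + f) ∸ col) ∎
      where
      open ≡-Reasoning
      open import Data.Nat.Solver using (module +-*-Solver)
      open +-*-Solver

  firstRowHooks⁻ : ∀ p rest → Linked _>_ rest → All (_< p) rest → ∀ h → h ∈ rowHooks (p ∷ rest) 0 p →
                   ∃ λ x → x < p + length rest × x ∉ betaSet rest × h ≡ (p + length rest) ∸ x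
  firstRowHooks⁻ p rest L a h hm with ∈-map⁻ _ hm
  ... | j , jm , refl = let j<p = ∈-upTo⁻ jm ; (bound , gap) = gapOf-gap rest p L a j j<p in
    gapOf rest j , bound , gap , firstRow-hook p rest j j<p

  firstRowHooks⁺ : ∀ p rest → Linked _>_ rest → All (_< p) rest → ∀ x → x < p + length rest → x ∉ betaSet rest →
                   ((p + length rest) ∸ x) ∈ rowHooks (p ∷ rest) 0 p
  firstRowHooks⁺ p rest L a x x< x∉ with gapOf-onto rest p L a x x< x∉
  ... | j , j<p , refl = subst (_∈ rowHooks (p ∷ rest) 0 p) (firstRow-hook p rest j j<p) (∈-map⁺ _ (∈-upTo⁺ j<p))

  hook⇒betaGap : ∀ λs → DistinctPartition λs → ∀ h → h ∈ hooks λs →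
                 ∃ λ b → ∃ λ x → b ∈ betaSet λs × x < b × x ∉ betaSet λs × h ≡ b ∸ x
  hook⇒betaGap (p ∷ rest) (pos , L) h hm
    with ∈-++⁻ (rowHooks (p ∷ rest) 0 p) (subst (h ∈_) (hooks-∷ p rest (All.map <⇒≤ (below-head L))) hm)
  ... | inj₁ m = let (x , x< , x∉ , e) = firstRowHooks⁻ p rest (Linked.tail L) (below-head L) h m
                 in p + length rest , x , here refl , x< , ∉-∷ (<⇒≢ x<) x∉ , e
  ... | inj₂ m = let (b , x , bm , x<b , x∉ , e) = hook⇒betaGap rest (All.tail pos , Linked.tail L) h m
                     b< = All.lookup (betaSet-bound p rest (below-head L)) bm
                 in b , x , there bm , x<b , ∉-∷ (<⇒≢ (<-trans x<b b<)) x∉ , e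

  betaGap⇒hook : ∀ λs → DistinctPartition λs → ∀ b x → b ∈ betaSet λs → x < b → x ∉ betaSet λs → (b ∸ x) ∈ hooks λs
  betaGap⇒hook (p ∷ rest) (pos , L) b x bm x<b x∉ = subst ((b ∸ x) ∈_) (sym (hooks-∷ p rest (All.map <⇒≤ (below-head L)))) (split bm)
    where
    split : b ∈ betaSet (p ∷ rest) → (b ∸ x) ∈ (rowHooks (p ∷ rest) 0 p ++ hooks rest)
    split (here refl) = ∈-++⁺ˡ (firstRowHooks⁺ p rest (Linked.tail L) (below-head L) x x<b (λ m → x∉ (there m)))
    split (there m) = ∈-++⁺ʳ (rowHooks (p ∷ rest) 0 p)
                        (betaGap⇒hook rest (All.tail pos , Linked.tail L) b x m x<b (λ m' → x∉ (there m')))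

  betaToPart : List ℕ → List ℕ
  betaToPart [] = []
  betaToPart (b ∷ bs) = (b ∸ length bs) ∷ betaToPart bs

  length-betaToPart : ∀ xs → length (betaToPart xs) ≡ length xs
  length-betaToPart [] = refl
  length-betaToPart (b ∷ bs) = cong suc (length-betaToPart bs)

  betaToPart-betaSet : ∀ λs → betaToPart (betaSet λs) ≡ λs
  betaToPart-betaSet [] = refl
  betaToPart-betaSet (p ∷ ps) =
    cong₂ _∷_ (trans (cong ((p + length ps) ∸_) (length-betaSet ps)) (m+n∸n≡m p (length ps))) (betaToPart-betaSet ps)

  length<head : ∀ {b bs} → Linked _>_ (b ∷ bs) → All (1 ≤_) (b ∷ bs) → length bs < b
  length<head [-] (p ∷ []) = p
  length<head (b>b' ∷ l) (_ ∷ a) = <-≤-trans (s≤s (length<head l a)) b>b'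

  betaSet-betaToPart : ∀ xs → Linked _>_ xs → All (1 ≤_) xs → betaSet (betaToPart xs) ≡ xs
  betaSet-betaToPart [] _ _ = refl
  betaSet-betaToPart (b ∷ bs) l a =
    cong₂ _∷_ (trans (cong ((b ∸ length bs) +_) (length-betaToPart bs)) (m∸n+n≡m (<⇒≤ (length<head l a))))
              (betaSet-betaToPart bs (Linked.tail l) (All.tail a))

  NoConsecutive : List ℕ → Set
  NoConsecutive xs = ∀ z → z ∈ xs → suc z ∈ xs → ⊥

  betaToPart-distinct : ∀ xs → Linked _>_ xs → All (1 ≤_) xs → NoConsecutive xs → DistinctPartition (betaToPart xs)
  betaToPart-distinct xs l a nc = positive xs l a , decreasing xs l a nc
    where
    positive : ∀ xs → Linked _>_ xs → All (1 ≤_) xs → All (0 <_) (betaToPart xs)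
    positive [] _ _ = []
    positive (b ∷ bs) l a = m<n⇒0<n∸m (length<head l a) ∷ positive bs (Linked.tail l) (All.tail a)
    decreasing : ∀ xs → Linked _>_ xs → All (1 ≤_) xs → NoConsecutive xs → Linked _>_ (betaToPart xs)
    decreasing [] _ _ _ = []
    decreasing (b ∷ []) _ _ _ = [-]
    decreasing (b ∷ b' ∷ bs) (b>b' ∷ l) (_ ∷ a) nc =
      step ∷ decreasing (b' ∷ bs) l a (λ z m₁ m₂ → nc z (there m₁) (there m₂))
      where
      b'+2≤b : suc (suc b') ≤ b
      b'+2≤b with m≤n⇒m<n∨m≡n b>b'
      ... | inj₁ lt = lt
      ... | inj₂ e = ⊥-elim (nc b' (there (here refl)) (here e))
      step : b' ∸ length bs < b ∸ suc (length bs)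
      step = ≤-trans (≤-reflexive (sym (+-∸-assoc 1 (<⇒≤ (length<head l a))))) (∸-monoˡ-≤ (suc (length bs)) b'+2≤b)

  size-betaToPart : ∀ xs → Linked _>_ xs → All (1 ≤_) xs → sum (betaToPart xs) + choose2 (length xs) ≡ sum xs
  size-betaToPart [] _ _ = refl
  size-betaToPart (b ∷ bs) l a = begin
    (b ∸ length bs) + sum (betaToPart bs) + (length bs + choose2 (length bs))
      ≡⟨ solve 4 (λ a b c d → a :+ b :+ (c :+ d) := (a :+ c) :+ (b :+ d)) refl
           (b ∸ length bs) (sum (betaToPart bs)) (length bs) (choose2 (length bs)) ⟩
    ((b ∸ length bs) + length bs) + (sum (betaToPart bs) + choose2 (length bs))
      ≡⟨ cong₂ _+_ (m∸n+n≡m (<⇒≤ (length<head l a))) (size-betaToPart bs (Linked.tail l) (All.tail a)) ⟩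
    b + sum bs ∎
    where
    open ≡-Reasoning
    open import Data.Nat.Solver using (module +-*-Solver)
    open +-*-Solver

  decreasing-ext : ∀ xs ys → Linked _>_ xs → Linked _>_ ys →
                   (∀ z → z ∈ xs → z ∈ ys) → (∀ z → z ∈ ys → z ∈ xs) → xs ≡ ys
  decreasing-ext [] [] _ _ _ _ = refl
  decreasing-ext [] (y ∷ ys) _ _ _ g with g y (here refl)
  ... | ()
  decreasing-ext (x ∷ xs) [] _ _ f _ with f x (here refl)
  ... | ()
  decreasing-ext (x ∷ xs) (y ∷ ys) lx ly f g = cong₂ _∷_ x≡y (decreasing-ext xs ys (Linked.tail lx) (Linked.tail ly) f' g')
    where
    ≤-head : ∀ {a as} {z} → Linked _>_ (a ∷ as) → z ∈ (a ∷ as) → z ≤ a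
    ≤-head l (here refl) = ≤-refl
    ≤-head l (there m) = <⇒≤ (All.lookup (below-head l) m)
    x≡y : x ≡ y
    x≡y = ≤-antisym (≤-head ly (f x (here refl))) (≤-head lx (g y (here refl)))
    f' : ∀ z → z ∈ xs → z ∈ ys
    f' z m with f z (there m)
    ... | here refl = ⊥-elim (<-irrefl (sym x≡y) (All.lookup (below-head lx) m))
    ... | there m' = m'
    g' : ∀ z → z ∈ ys → z ∈ xs
    g' z m with g z (there m)
    ... | here refl = ⊥-elim (<-irrefl x≡y (All.lookup (below-head ly) m))
    ... | there m' = m'

  GapTwo : ℕ → ℕ → Set
  GapTwo a b = suc (suc b) ≤ a

  betaSet-gapTwo : ∀ λs → DistinctPartition λs → Linked GapTwo (betaSet λs)
  betaSet-gapTwo [] _ = []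
  betaSet-gapTwo (p ∷ []) _ = [-]
  betaSet-gapTwo (p ∷ q ∷ rest) (pa , (p>q ∷ l)) = gap ∷ betaSet-gapTwo (q ∷ rest) (All.tail pa , l)
    where
    gap : suc (suc (q + length rest)) ≤ p + suc (length rest)
    gap = subst (suc (suc (q + length rest)) ≤_) (sym (+-suc p (length rest))) (s≤s (+-monoˡ-≤ (length rest) p>q))

  betaSet-positive : ∀ λs → DistinctPartition λs → All (1 ≤_) (betaSet λs)
  betaSet-positive [] _ = []
  betaSet-positive (p ∷ ps) (pa ∷ a , l) = ≤-trans pa (m≤m+n p (length ps)) ∷ betaSet-positive ps (a , Linked.tail l)

  gapTwo⇒decreasing : ∀ {xs} → Linked GapTwo xs → Linked _>_ xs
  gapTwo⇒decreasing = Linked.map (λ g → <-trans (n<1+n _) g)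

  gapTwo-below-head : ∀ {x xs} → Linked GapTwo (x ∷ xs) → All (GapTwo x) xs
  gapTwo-below-head [-] = []
  gapTwo-below-head (r ∷ l) = Linked⇒All (λ ab bc → ≤-trans (s≤s (s≤s (≤-trans (n≤1+n _) (≤-trans (n≤1+n _) bc)))) ab) r l

  gapTwo⇒noConsecutive : ∀ xs → Linked GapTwo xs → NoConsecutive xs
  gapTwo⇒noConsecutive [] _ z ()
  gapTwo⇒noConsecutive (x ∷ xs) l z (here refl) (here e) = 1+n≢n e
  gapTwo⇒noConsecutive (x ∷ xs) l z (here refl) (there m) =
    1+n≰n (≤-trans (≤-trans (n≤1+n (suc x)) (n≤1+n (suc (suc x)))) (All.lookup (gapTwo-below-head l) m))
  gapTwo⇒noConsecutive (x ∷ xs) l z (there m) (here refl) = 1+n≰n (All.lookup (gapTwo-below-head l) m)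
  gapTwo⇒noConsecutive (x ∷ xs) l z (there m) (there m') = gapTwo⇒noConsecutive xs (Linked.tail l) z m m'

  unique-perm : ∀ (xs ys : List ℕ) → Unique xs → Unique ys →
                (∀ z → z ∈ xs → z ∈ ys) → (∀ z → z ∈ ys → z ∈ xs) → xs ↭ ys
  unique-perm [] [] _ _ _ _ = ↭-refl
  unique-perm [] (y ∷ ys) _ _ _ g with g y (here refl)
  ... | ()
  unique-perm (x ∷ xs) ys (px ∷ ux) uy f g with ∈-∃++ (f x (here refl))
  ... | as , bs , refl = ↭-trans (prep x (unique-perm xs (as ++ bs) ux (proj₁ removed) f' g')) (↭-sym (PermP.shift x as bs))
    where
    remove : ∀ as bs → Unique (as ++ x ∷ bs) → Unique (as ++ bs) × x ∉ (as ++ bs)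
    remove [] bs (px ∷ u) = u , λ m → All.lookup px m refl
    remove (a ∷ as) bs (pa ∷ u) =
      let (u' , x∉) = remove as bs u
          (pa₁ , pa₂) = AllP.++⁻ as pa
      in (AllP.++⁺ pa₁ (All.tail pa₂) ∷ u') , λ { (here e) → All.head pa₂ (sym e) ; (there m) → x∉ m }
    removed = remove as bs uy
    f' : ∀ z → z ∈ xs → z ∈ (as ++ bs)
    f' z m with ∈-++⁻ as (f z (there m))
    ... | inj₁ m₁ = ∈-++⁺ˡ m₁
    ... | inj₂ (here e) = ⊥-elim (All.lookup px (subst (_∈ xs) e m) refl)
    ... | inj₂ (there m₂) = ∈-++⁺ʳ as m₂
    insert : ∀ {z} → z ∈ (as ++ bs) → z ∈ (as ++ x ∷ bs)
    insert m with ∈-++⁻ as m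
    ... | inj₁ m₁ = ∈-++⁺ˡ m₁
    ... | inj₂ m₂ = ∈-++⁺ʳ as (there m₂)
    g' : ∀ z → z ∈ (as ++ bs) → z ∈ xs
    g' z m with g z (insert m)
    ... | here e = ⊥-elim (proj₂ removed (subst (_∈ (as ++ bs)) e m))
    ... | there m' = m'

-- The correspondence between n-cores with distinct parts and independent vectors, for
-- n = n' + 1.  A vector m ∈ ℕ^n' determines the set β(m) = {k + 1 + j·n : k < n', j < mₖ}
-- and the partition `partitionOf m` with that beta-set.
module CoreVectors (n' : ℕ) where
  open import Data.Nat as ℕ using (ℕ; zero; suc; _+_; _*_; _∸_; _≤_; _<_; _>_; z≤n; s≤s; _≟_; _<?_; _≤?_)
  open import Data.Nat.Properties
  open import Data.Nat.DivMod using (_%_; [m+kn]%n≡m%n; m<n⇒m%n≡m)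
  open import Data.Nat.Divisibility using (_∣_; divides; ∣-refl; >⇒∤)
  open import Data.List using (List; []; _∷_; _++_; map; length; filter; downFrom; [_])
  import Data.List.Properties as LP
  open import Data.Nat.ListAction using (sum)
  open import Data.Nat.ListAction.Properties using (sum-++; sum-↭)
  open import Data.Vec using (Vec; []; _∷_)
  open import Data.List.Relation.Unary.All using (All; []; _∷_)
  import Data.List.Relation.Unary.All as All
  open import Data.List.Relation.Unary.AllPairs using (AllPairs; []; _∷_)
  import Data.List.Relation.Unary.AllPairs as AllPairs
  open import Data.List.Relation.Unary.Linked using (Linked)
  import Data.List.Relation.Unary.Linked.Properties as LinkP
  open import Data.List.Relation.Unary.Unique.Propositional using (Unique)
  import Data.List.Relation.Unary.Unique.Propositional.Properties as UP
  open import Data.List.Membership.Propositional using (_∈_; _∉_)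
  open import Data.List.Membership.Propositional.Properties
    using (∈-map⁺; ∈-map⁻; ∈-++⁺ˡ; ∈-++⁺ʳ; ∈-++⁻; ∈-filter⁺; ∈-filter⁻; ∈-downFrom⁺; ∈-downFrom⁻)
  open import Data.List.Membership.DecPropositional _≟_ using (_∈?_)
  open import Data.List.Relation.Unary.Any using (here; there)
  open import Data.Product using (_×_; _,_; proj₁; proj₂; ∃)
  open import Data.Sum using (_⊎_; inj₁; inj₂)
  open import Data.Empty using (⊥-elim; ⊥)
  open import Relation.Nullary using (¬_; yes; no; Dec)
  open import Relation.Binary.PropositionalEquality hiding ([_])
  open import Defs
  open import Relation.Binary.Definitions using (tri<; tri≈; tri>)
  open import Data.List.Relation.Binary.Permutation.Propositional using (_↭_)
  open DegreeLemmas using (choose2)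
  open BetaSets
  open IndependentVectors using (entry; NoAdjacent)

  n : ℕ
  n = suc n'

  division-unique : ∀ a b j j' → a < n → b < n → a + j * n ≡ b + j' * n → a ≡ b × j ≡ j'
  division-unique a b j j' a<n b<n e = a≡b , *-cancelʳ-≡ j j' n (+-cancelˡ-≡ a _ _ (trans e (cong (_+ j' * n) (sym a≡b))))
    where
    a≡b : a ≡ b
    a≡b = trans (sym (m<n⇒m%n≡m a<n)) (trans (sym ([m+kn]%n≡m%n a j n))
            (trans (cong (_% n) e) (trans ([m+kn]%n≡m%n b j' n) (m<n⇒m%n≡m b<n))))

  downFrom-decreasing : ∀ a → Linked _>_ (downFrom a)
  downFrom-decreasing a = LinkP.applyDownFrom⁺₂ (λ x → x) a (λ i → ≤-refl)

  -- betaFrom r m lists r + k + j·n for j < mₖ (columns of an n-abacus starting at runner r).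
  betaFrom : ℕ → ∀ {w} → Vec ℕ w → List ℕ
  betaFrom r [] = []
  betaFrom r (a ∷ as) = map (λ j → r + j * n) (downFrom a) ++ betaFrom (suc r) as

  ∈-betaFrom⁻ : ∀ r {w} (as : Vec ℕ w) z → z ∈ betaFrom r as → ∃ λ k → ∃ λ j → j < entry as k × z ≡ r + k + j * n
  ∈-betaFrom⁻ r (a ∷ as) z m with ∈-++⁻ (map (λ j → r + j * n) (downFrom a)) m
  ... | inj₁ m1 with ∈-map⁻ _ m1
  ... | j , jm , e = 0 , j , ∈-downFrom⁻ jm , trans e (cong (λ q → q + j * n) (sym (+-identityʳ r)))
  ∈-betaFrom⁻ r (a ∷ as) z m | inj₂ m2 with ∈-betaFrom⁻ (suc r) as z m2
  ... | k , j , lt , e = suc k , j , lt , trans e (cong (λ q → q + j * n) (sym (+-suc r k)))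

  ∈-betaFrom⁺ : ∀ r {w} (as : Vec ℕ w) k j → j < entry as k → r + k + j * n ∈ betaFrom r as
  ∈-betaFrom⁺ r (a ∷ as) zero j lt = ∈-++⁺ˡ (subst (_∈ map (λ j → r + j * n) (downFrom a))
    (cong (λ q → q + j * n) (sym (+-identityʳ r))) (∈-map⁺ _ (∈-downFrom⁺ lt)))
  ∈-betaFrom⁺ r (a ∷ as) (suc k) j lt = ∈-++⁺ʳ _ (subst (_∈ betaFrom (suc r) as)
    (cong (λ q → q + j * n) (sym (+-suc r k))) (∈-betaFrom⁺ (suc r) as k j lt))

  entry-bound : ∀ {w} (as : Vec ℕ w) k {j} → j < entry as k → k < w
  entry-bound [] k ()
  entry-bound (a ∷ as) zero lt = s≤s z≤n
  entry-bound (a ∷ as) (suc k) lt = s≤s (entry-bound as k lt)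

  betaOf : Vec ℕ n' → List ℕ
  betaOf m = betaFrom 1 m

  ∈-betaOf⁻ : ∀ m z → z ∈ betaOf m → ∃ λ k → ∃ λ j → j < entry m k × z ≡ suc k + j * n
  ∈-betaOf⁻ m z zm = ∈-betaFrom⁻ 1 m z zm

  ∈-betaOf⁺ : ∀ m k j → j < entry m k → suc k + j * n ∈ betaOf m
  ∈-betaOf⁺ m k j lt = ∈-betaFrom⁺ 1 m k j lt

  ≤-sum : ∀ {z} xs → z ∈ xs → z ≤ sum xs
  ≤-sum (x ∷ xs) (here refl) = m≤m+n x (sum xs)
  ≤-sum (x ∷ xs) (there m) = ≤-trans (≤-sum xs m) (m≤n+m (sum xs) x)

  betaSorted : Vec ℕ n' → List ℕ
  betaSorted m = filter (_∈? betaOf m) (downFrom (suc (sum (betaOf m))))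

  partitionOf : Vec ℕ n' → List ℕ
  partitionOf m = betaToPart (betaSorted m)

  betaSorted-decreasing : ∀ m → Linked _>_ (betaSorted m)
  betaSorted-decreasing m = LinkP.filter⁺ (_∈? betaOf m) (λ {a} {b} {c} ab bc → <-trans bc ab) (downFrom-decreasing _)

  ∈-betaSorted⁻ : ∀ m {z} → z ∈ betaSorted m → z ∈ betaOf m
  ∈-betaSorted⁻ m zm = proj₂ (∈-filter⁻ (_∈? betaOf m) zm)

  ∈-betaSorted⁺ : ∀ m {z} → z ∈ betaOf m → z ∈ betaSorted m
  ∈-betaSorted⁺ m zm = ∈-filter⁺ (_∈? betaOf m) (∈-downFrom⁺ (s≤s (≤-sum _ zm))) zm

  betaSorted-positive : ∀ m → All (1 ≤_) (betaSorted m)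
  betaSorted-positive m = All.tabulate (λ {z} zm → help (∈-betaOf⁻ m z (∈-betaSorted⁻ m zm)))
    where help : ∀ {z} → (∃ λ k → ∃ λ j → j < entry m k × z ≡ suc k + j * n) → 1 ≤ z
          help (k , j , _ , refl) = s≤s z≤n

  decreasing⇒unique : ∀ {xs : List ℕ} → Linked _>_ xs → Unique xs
  decreasing⇒unique l = AllPairs.map (λ gt e → <-irrefl (sym e) gt) (LinkP.Linked⇒AllPairs (λ {a} {b} {c} ab bc → <-trans bc ab) l)

  betaSum : ℕ → ∀ {w} → Vec ℕ w → ℕ
  betaSum r [] = 0
  betaSum r (a ∷ as) = (r * a + n * choose2 a) + betaSum (suc r) as

  total : ∀ {w} → Vec ℕ w → ℕ
  total [] = 0
  total (a ∷ as) = a + total as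

  sum-column : ∀ r a → sum (map (λ j → r + j * n) (downFrom a)) ≡ r * a + n * choose2 a
  sum-column r zero = sym (cong₂ _+_ (*-zeroʳ r) (*-zeroʳ n))
  sum-column r (suc a) rewrite sum-column r a = e r a (choose2 a)
    where
    open import Data.Nat.Solver as NS using ()
    open NS.+-*-Solver
    e : ∀ r a c → r + a * n + (r * a + n * c) ≡ r * suc a + n * (a + c)
    e r a c = solve 4 (λ r a c n → r :+ a :* n :+ (r :* a :+ n :* c) := r :* (con 1 :+ a) :+ n :* (a :+ c)) refl r a c n

  sum-betaFrom : ∀ r {w} (as : Vec ℕ w) → sum (betaFrom r as) ≡ betaSum r as
  sum-betaFrom r [] = refl
  sum-betaFrom r (a ∷ as) = trans (sum-++ (map (λ j → r + j * n) (downFrom a)) _) (cong₂ _+_ (sum-column r a) (sum-betaFrom (suc r) as))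

  length-betaFrom : ∀ r {w} (as : Vec ℕ w) → length (betaFrom r as) ≡ total as
  length-betaFrom r [] = refl
  length-betaFrom r (a ∷ as) = trans (LP.length-++ (map (λ j → r + j * n) (downFrom a)))
    (cong₂ _+_ (trans (LP.length-map _ (downFrom a)) (LP.length-downFrom a)) (length-betaFrom (suc r) as))

  -- Distinct (runner, row) pairs give distinct positions, since runners are below n.
  unique-betaFrom : ∀ r {w} (as : Vec ℕ w) → r + w ≤ n → Unique (betaFrom r as)
  unique-betaFrom r [] h = []
  unique-betaFrom r {suc w'} (a ∷ as) h = UP.++⁺ u1 (unique-betaFrom (suc r) as h') dis
    where
    h' : suc r + w' ≤ n
    h' = subst (_≤ n) (+-suc r w') h
    u1 : Unique (map (λ j → r + j * n) (downFrom a))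
    u1 = UP.map⁺ (λ {j} {j'} e → *-cancelʳ-≡ j j' n (+-cancelˡ-≡ r _ _ e)) (decreasing⇒unique (downFrom-decreasing a))
    r<n : r < n
    r<n = <-≤-trans (subst (r <_) (sym (+-suc r w')) (s≤s (m≤m+n r w'))) h
    dis : ∀ {z} → ¬ (z ∈ map (λ j → r + j * n) (downFrom a) × z ∈ betaFrom (suc r) as)
    dis (m1 , m2) with ∈-map⁻ _ m1 | ∈-betaFrom⁻ (suc r) as _ m2
    ... | j , _ , refl | k , j' , lt , e =
      let k<w = entry-bound as k lt
          b<n = <-≤-trans (+-monoʳ-< (suc r) k<w) h'
      in m≢1+m+n r (proj₁ (division-unique r (suc r + k) j j' r<n b<n e))

  unique-betaOf : ∀ m → Unique (betaOf m)
  unique-betaOf m = unique-betaFrom 1 m ≤-refl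

  betaSorted↭betaOf : ∀ m → betaSorted m ↭ betaOf m
  betaSorted↭betaOf m = unique-perm (betaSorted m) (betaOf m) (decreasing⇒unique (betaSorted-decreasing m)) (unique-betaOf m)
    (λ z zm → ∈-betaSorted⁻ m zm) (λ z zm → ∈-betaSorted⁺ m zm)

  size-partitionOf : ∀ m → sum (partitionOf m) + choose2 (total m) ≡ betaSum 1 m
  size-partitionOf m = begin
    sum (partitionOf m) + choose2 (total m)
      ≡⟨ cong (λ q → sum (partitionOf m) + choose2 q) (sym (trans (PermP.↭-length (betaSorted↭betaOf m)) (length-betaFrom 1 m))) ⟩
    sum (partitionOf m) + choose2 (length (betaSorted m)) ≡⟨ size-betaToPart (betaSorted m) (betaSorted-decreasing m) (betaSorted-positive m) ⟩
    sum (betaSorted m) ≡⟨ sum-↭ (betaSorted↭betaOf m) ⟩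
    sum (betaOf m) ≡⟨ sum-betaFrom 1 m ⟩
    betaSum 1 m ∎
    where
    open ≡-Reasoning
    import Data.List.Relation.Binary.Permutation.Propositional.Properties as PermP

  -- Consecutive elements of β(m) would lie on adjacent runners k, k+1 with positive entries
  -- (when k + 2 = n the successor would be a multiple of n); NoAdjacent rules this out.
  betaOf-noConsecutive : ∀ m → NoAdjacent m → NoConsecutive (betaOf m)
  betaOf-noConsecutive m adj z zm szm with ∈-betaOf⁻ m z zm | ∈-betaOf⁻ m (suc z) szm
  ... | k , j , lt , refl | k' , j' , lt' , e with <-cmp (suc (suc k)) n
  ... | tri< ssk<n _ _ =
    let (e1 , e2) = division-unique (suc (suc k)) (suc k') j j' ssk<n (s≤s (entry-bound m k' lt')) e
        pos1 : 0 < entry m k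
        pos1 = ≤-<-trans z≤n lt
        pos2 : 0 < entry m (suc k)
        pos2 = ≤-<-trans z≤n (subst (λ q → j' < entry m q) (sym (suc-injective e1)) lt')
    in case (adj k) pos1 pos2
    where
    case : entry m k ≡ 0 ⊎ entry m (suc k) ≡ 0 → 0 < entry m k → 0 < entry m (suc k) → ⊥
    case (inj₁ e) p _ = <-irrefl (sym e) p
    case (inj₂ e) _ p = <-irrefl (sym e) p
  ... | tri≈ _ ssk≡n _ = 0≢1+n (proj₁ (division-unique 0 (suc k') (suc j) j' (s≤s z≤n) (s≤s (entry-bound m k' lt')) (trans e0 e)))
    where
    e0 : 0 + suc j * n ≡ suc (suc k + j * n)
    e0 = trans (cong (_+ j * n) (sym ssk≡n)) refl
  ... | tri> _ _ gt = ⊥-elim (<-irrefl refl (<-≤-trans gt (s≤s (entry-bound m k lt))))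

  betaSorted-noConsecutive : ∀ m → NoAdjacent m → NoConsecutive (betaSorted m)
  betaSorted-noConsecutive m adj z zm szm = betaOf-noConsecutive m adj z (∈-betaSorted⁻ m zm) (∈-betaSorted⁻ m szm)

  partitionOf-distinct : ∀ m → NoAdjacent m → DistinctPartition (partitionOf m)
  partitionOf-distinct m adj = betaToPart-distinct (betaSorted m) (betaSorted-decreasing m) (betaSorted-positive m) (betaSorted-noConsecutive m adj)

  betaSet-partitionOf : ∀ m → betaSet (partitionOf m) ≡ betaSorted m
  betaSet-partitionOf m = betaSet-betaToPart (betaSorted m) (betaSorted-decreasing m) (betaSorted-positive m)

  hooks-partitionOf : ∀ m → NoAdjacent m → ∀ h → h ∈ hooks (partitionOf m) →
                      ∃ λ b → ∃ λ x → b ∈ betaSorted m × x < b × x ∉ betaSorted m × h ≡ b ∸ x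
  hooks-partitionOf m adj h hm with hook⇒betaGap (partitionOf m) (partitionOf-distinct m adj) h hm
  ... | b , x , bm , x<b , x∉ , e = b , x , subst (b ∈_) (betaSet-partitionOf m) bm , x<b , subst (x ∉_) (betaSet-partitionOf m) x∉ , e

  -- No hook is divisible by n: if b - x = q·n then x = b - q·n lies on the same runner below b,
  -- hence in β(m) (or q·n exceeds b).
  partitionOf-nCore : ∀ m → NoAdjacent m → IsCore n (partitionOf m)
  partitionOf-nCore m adj = All.tabulate λ {h} hm → indivisible (hooks-partitionOf m adj h hm)
    where
    indivisible : ∀ {h} → (∃ λ b → ∃ λ x → b ∈ betaSorted m × x < b × x ∉ betaSorted m × h ≡ b ∸ x) → ¬ (n ∣ h)
    indivisible (b , x , bm , x<b , x∉ , refl) (divides q eq) with ∈-betaOf⁻ m b (∈-betaSorted⁻ m bm)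
    ... | k , j , lt , refl with q ℕ.≤? j
    ... | no q≰j = <-irrefl refl (<-≤-trans big (≤-reflexive sumeq))
      where
      sumeq : x + q * n ≡ suc k + j * n
      sumeq = trans (cong (x +_) (sym eq)) (m+[n∸m]≡n (<⇒≤ x<b))
      big : suc k + j * n < x + q * n
      big = <-≤-trans (+-monoˡ-< (j * n) (s≤s (entry-bound m k lt))) (≤-trans (*-monoˡ-≤ n (≰⇒> q≰j)) (m≤n+m (q * n) x))
    ... | yes q≤j = x∉ (subst (_∈ betaSorted m) (sym xeq) (∈-betaSorted⁺ m (∈-betaOf⁺ m k (j ∸ q) (≤-<-trans (m∸n≤m j q) lt))))
      where
      open import Data.Nat.Solver as NS using ()
      open NS.+-*-Solver
      sumeq : x + q * n ≡ suc k + j * n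
      sumeq = trans (cong (x +_) (sym eq)) (m+[n∸m]≡n (<⇒≤ x<b))
      xeq : x ≡ suc k + (j ∸ q) * n
      xeq = +-cancelʳ-≡ (q * n) x _ (trans sumeq (trans (cong (λ z → suc k + z * n) (sym (m∸n+n≡m q≤j)))
              (solve 4 (λ k a b n → con 1 :+ k :+ (a :+ b) :* n := con 1 :+ k :+ a :* n :+ b :* n) refl k (j ∸ q) q n)))

  -- Hooks are at most max β(m), so all of β(m) below t makes partitionOf m a t-core.
  partitionOf-tCore : ∀ t m → NoAdjacent m → (∀ k j → j < entry m k → suc k + j * n < t) → IsCore t (partitionOf m)
  partitionOf-tCore t m adj below-t = All.tabulate λ {h} hm → indivisible (hooks-partitionOf m adj h hm)
    where
    indivisible : ∀ {h} → (∃ λ b → ∃ λ x → b ∈ betaSorted m × x < b × x ∉ betaSorted m × h ≡ b ∸ x) → ¬ (t ∣ h)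
    indivisible (b , x , bm , x<b , x∉ , refl) with ∈-betaOf⁻ m b (∈-betaSorted⁻ m bm)
    ... | k , j , lt , e = >⇒∤ {{ℕ.>-nonZero (m<n⇒0<n∸m x<b)}} (≤-<-trans (m∸n≤m b x) (subst (_< t) (sym e) (below-t k j lt)))

  partitionOf-sound : ∀ t m → NoAdjacent m → (∀ k j → j < entry m k → suc k + j * n < t) → InC n t (partitionOf m)
  partitionOf-sound t m adj below-t = partitionOf-distinct m adj , partitionOf-nCore m adj , partitionOf-tCore t m adj below-t

  vecOf : (w : ℕ) → (ℕ → ℕ) → Vec ℕ w
  vecOf zero f = []
  vecOf (suc w) f = f 0 ∷ vecOf w (λ k → f (suc k))

  entry-vecOf : ∀ w f k → k < w → entry (vecOf w f) k ≡ f k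
  entry-vecOf (suc w) f zero _ = refl
  entry-vecOf (suc w) f (suc k) (s≤s lt) = entry-vecOf w (λ k → f (suc k)) k lt

  entry-beyond : ∀ {w} (as : Vec ℕ w) k → w ≤ k → entry as k ≡ 0
  entry-beyond [] k _ = refl
  entry-beyond (a ∷ as) (suc k) (s≤s le) = entry-beyond as k le

  module PrefixLength where
    prefixLength : ∀ {Q : ℕ → Set} → (∀ j → Dec (Q j)) → ℕ → ℕ
    prefixLength Q? zero = 0
    prefixLength Q? (suc f) with Q? 0
    ... | yes _ = suc (prefixLength (λ j → Q? (suc j)) f)
    ... | no _ = 0

    prefixLength-sound : ∀ {Q : ℕ → Set} (Q? : ∀ j → Dec (Q j)) f j → j < prefixLength Q? f → Q j
    prefixLength-sound Q? (suc f) j lt with Q? 0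
    prefixLength-sound Q? (suc f) zero lt | yes q = q
    prefixLength-sound Q? (suc f) (suc j) (s≤s lt) | yes q = prefixLength-sound (λ j → Q? (suc j)) f j lt
    prefixLength-sound Q? (suc f) j () | no _

    downward-to-0 : ∀ {Q : ℕ → Set} → (∀ j → Q (suc j) → Q j) → ∀ j → Q j → Q 0
    downward-to-0 down zero q = q
    downward-to-0 down (suc j) q = downward-to-0 down j (down j q)

    prefixLength-complete : ∀ {Q : ℕ → Set} (Q? : ∀ j → Dec (Q j)) f → (∀ j → Q (suc j) → Q j) → (∀ j → Q j → j < f) →
                            ∀ j → Q j → j < prefixLength Q? f
    prefixLength-complete Q? zero down bounded j q = bounded j q
    prefixLength-complete Q? (suc f) down bounded j q with Q? 0
    ... | no ¬q0 = ⊥-elim (¬q0 (downward-to-0 down j q))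
    prefixLength-complete Q? (suc f) down bounded zero q | yes _ = s≤s z≤n
    prefixLength-complete Q? (suc f) down bounded (suc j) q | yes _ =
      s≤s (prefixLength-complete (λ j → Q? (suc j)) f (λ j → down (suc j)) (λ j qj → ≤-pred (bounded (suc j) qj)) j q)
  open PrefixLength

  module FromCore (λs : List ℕ) (dp : DistinctPartition λs) where
    β = betaSet λs
    βpositive = betaSet-positive λs dp
    βgapTwo = betaSet-gapTwo λs dp
    βdecreasing = gapTwo⇒decreasing βgapTwo
    βnoConsecutive = gapTwo⇒noConsecutive β βgapTwo

    0∉β : 0 ∉ β
    0∉β zm with All.lookup βpositive zm
    ... | ()

    -- For an s-core, b ∈ β and s ≤ b imply b - s ∈ β (otherwise s would be a hook),
    -- and no element of β is a multiple of s (otherwise it would be a hook with x = 0).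
    beta-closed-∸ : ∀ s → IsCore s λs → 0 < s → ∀ b → b ∈ β → s ≤ b → (b ∸ s) ∈ β
    beta-closed-∸ s core s>0 b bm s≤b with (b ∸ s) ∈? β
    ... | yes x∈ = x∈
    ... | no x∉ = ⊥-elim (All.lookup core (subst (_∈ hooks λs) (m∸[m∸n]≡n s≤b)
                    (betaGap⇒hook λs dp b (b ∸ s) bm (∸-monoʳ-< {b} {s} {0} s>0 s≤b) x∉)) ∣-refl)

    beta-not-multiple : ∀ s → IsCore s λs → ∀ b → b ∈ β → ¬ (s ∣ b)
    beta-not-multiple s core b bm = All.lookup core (betaGap⇒hook λs dp b 0 bm (All.lookup βpositive bm) 0∉β)

    module _ (nCore : IsCore n λs) where
      -- mₖ is the number of rows j with k + 1 + j·n ∈ β, each column being an initial segment.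
      inBeta? : ∀ k j → Dec (suc k + j * n ∈ β)
      inBeta? k j = (suc k + j * n) ∈? β

      searchBound = suc (sum β)

      vector : Vec ℕ n'
      vector = vecOf n' (λ k → prefixLength (inBeta? k) searchBound)

      column-downward : ∀ k j → suc k + suc j * n ∈ β → suc k + j * n ∈ β
      column-downward k j bm =
        subst (_∈ β) e (beta-closed-∸ n nCore (s≤s z≤n) _ bm (≤-trans (m≤n+m n (suc k + j * n)) (≤-reflexive e2)))
        where
        open import Data.Nat.Solver as NS using ()
        open NS.+-*-Solver
        e2 : suc k + j * n + n ≡ suc k + suc j * n
        e2 = solve 3 (λ k j n → con 1 :+ k :+ j :* n :+ n := con 1 :+ k :+ (con 1 :+ j) :* n) refl k j n
        e : suc k + suc j * n ∸ n ≡ suc k + j * n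
        e = trans (cong (_∸ n) (sym e2)) (m+n∸n≡m _ n)

      column-bounded : ∀ k j → suc k + j * n ∈ β → j < searchBound
      column-bounded k j bm = s≤s (≤-trans (m≤m*n j n) (≤-trans (m≤n+m (j * n) (suc k)) (≤-sum β bm)))

      column-base : ∀ k j → suc k + j * n ∈ β → suc k ∈ β
      column-base k j bm = subst (_∈ β) (+-identityʳ (suc k)) (downward-to-0 (column-downward k) j bm)

      entry-vector : ∀ k → k < n' → entry vector k ≡ prefixLength (inBeta? k) searchBound
      entry-vector k lt = entry-vecOf n' (λ k → prefixLength (inBeta? k) searchBound) k lt

      -- β(m) = β(λ): every element of β is k + 1 + j·n since it is not a multiple of n.
      betaOf-vector⊆ : ∀ z → z ∈ betaOf vector → z ∈ β
      betaOf-vector⊆ z zm with ∈-betaOf⁻ vector z zm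
      ... | k , j , lt , refl = prefixLength-sound (inBeta? k) searchBound j (subst (j <_) (entry-vector k (entry-bound vector k lt)) lt)

      betaOf-vector⊇ : ∀ z → z ∈ β → z ∈ betaOf vector
      betaOf-vector⊇ z zm = subst (_∈ betaOf vector) (sym ze) (∈-betaOf⁺ vector k j jlt)
        where
        open import Data.Nat.DivMod using (_/_; m≡m%n+[m/n]*n; m%n<n)
        r = z % n
        j = z / n
        zeq : z ≡ r + j * n
        zeq = m≡m%n+[m/n]*n z n
        r≢0 : r ≢ 0
        r≢0 e = beta-not-multiple n nCore z zm (divides j (trans zeq (cong (_+ j * n) e)))
        k = ℕ.pred r
        sk : suc k ≡ r
        sk = suc-pred r {{ℕ.≢-nonZero r≢0}}
        ze : z ≡ suc k + j * n
        ze = trans zeq (cong (_+ j * n) (sym sk))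
        k<n' : k < n'
        k<n' = ≤-pred (subst (_< n) (sym sk) (m%n<n z n))
        jlt : j < entry vector k
        jlt = subst (j <_) (sym (entry-vector k k<n'))
                (prefixLength-complete (inBeta? k) searchBound (column-downward k) (column-bounded k) j (subst (_∈ β) ze zm))

      partitionOf-vector : partitionOf vector ≡ λs
      partitionOf-vector = trans (cong betaToPart (decreasing-ext (betaSorted vector) β (betaSorted-decreasing vector) βdecreasing
                                      (λ z zm → betaOf-vector⊆ z (∈-betaSorted⁻ vector zm))
                                      (λ z zm → ∈-betaSorted⁺ vector (betaOf-vector⊇ z zm))))
                    (betaToPart-betaSet λs)

      positive⇒base : ∀ k → 0 < entry vector k → suc k ∈ β
      positive⇒base k p = subst (_∈ β) (+-identityʳ (suc k))
        (prefixLength-sound (inBeta? k) searchBound 0 (subst (0 <_) (entry-vector k (entry-bound vector k p)) p))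

      -- Adjacent positive entries would put the consecutive numbers k + 1, k + 2 into β.
      vector-noAdjacent : NoAdjacent vector
      vector-noAdjacent k with entry vector k ℕ.≟ 0 | entry vector (suc k) ℕ.≟ 0
      ... | yes e | _ = inj₁ e
      ... | _ | yes e = inj₂ e
      ... | no a | no b = ⊥-elim (βnoConsecutive (suc k) (positive⇒base k (n≢0⇒n>0 a)) (positive⇒base (suc k) (n≢0⇒n>0 b)))

      vector-below : ∀ {bs : Vec ℕ n'} → (∀ k → k < n' → suc k + entry bs k * n ∉ β) → ∀ k → entry vector k ≤ entry bs k
      vector-below {bs} outside k with k <? n'
      ... | no k≮ = ≤-trans (≤-reflexive (entry-beyond vector k (≮⇒≥ k≮))) z≤n
      ... | yes k< with entry vector k ≤? entry bs k
      ...   | yes le = le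
      ...   | no nle = ⊥-elim (outside k k< (prefixLength-sound (inBeta? k) searchBound (entry bs k)
                                             (subst (entry bs k <_) (entry-vector k k<) (≰⇒> nle))))

  entry-ext : ∀ {w} (u v : Vec ℕ w) → (∀ k → entry u k ≡ entry v k) → u ≡ v
  entry-ext [] [] _ = refl
  entry-ext (a ∷ u) (b ∷ v) e = cong₂ _∷_ (e 0) (entry-ext u v (λ k → e (suc k)))

  entry-transfer : ∀ m m' → betaSorted m ≡ betaSorted m' → ∀ k j → j < entry m k → j < entry m' k
  entry-transfer m m' e k j lt with ∈-betaOf⁻ m' _ (∈-betaSorted⁻ m' (subst (_ ∈_) e (∈-betaSorted⁺ m (∈-betaOf⁺ m k j lt))))
  ... | k' , j' , lt' , eq with division-unique (suc k) (suc k') j j' (s≤s (entry-bound m k lt)) (s≤s (entry-bound m' k' lt')) eq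
  ... | refl , refl = lt'

  partitionOf-injective : ∀ {m m'} → partitionOf m ≡ partitionOf m' → m ≡ m'
  partitionOf-injective {m} {m'} e = entry-ext m m' (λ k → ≤-antisym (le m m' βe k) (le m' m (sym βe) k))
    where
    βe : betaSorted m ≡ betaSorted m'
    βe = trans (sym (betaSet-partitionOf m)) (trans (cong betaSet e) (betaSet-partitionOf m'))
    le : ∀ a b → betaSorted a ≡ betaSorted b → ∀ k → entry a k ≤ entry b k
    le a b eab k with entry a k ℕ.≤? entry b k
    ... | yes p = p
    ... | no np = ⊥-elim (<-irrefl refl (entry-transfer a b eab k (entry b k) (≰⇒> np)))


-- |λ(m)| = Σ β(m) - (ℓ choose 2) with Σ β(m) = Σₖ ((k+1)·mₖ + n·(mₖ choose 2)) and
-- ℓ = Σₖ mₖ, a polynomial of degree ≤ 2 in m; hence |λ(m)|^k has degree ≤ 2k.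
module SizeDegree (n' : ℕ) where
  open import Data.Nat using (zero; suc; _+_; _*_)
  import Data.Nat.Properties as ℕP
  open import Data.Unit using (⊤; tt)
  open import Data.Vec using (Vec; []; _∷_; tail)
  open import Data.Product using (_×_; _,_; proj₂)
  open import Data.Rational using (ℚ) renaming (_+_ to _+ℚ_; _*_ to _*ℚ_; _-_ to _-ℚ_)
  open import Data.Rational.Solver
  open +-*-Solver
  open import Relation.Binary.PropositionalEquality
  open import Defs using (size)
  open NatEmbedding
  open FiniteDifferences
  open DegreeLemmas using (choose2; DegLt-additive; DegLt-choose2)
  open IndependentVectors using (withVec)
  open CoreVectors n'

  -- Vectors carry a trivial parameter in ⊤, the form used by `sumIndependent`.
  Params : ℕ → Set
  Params w = ⊤ × Vec ℕ w

  params : ∀ w → Shifts (Params w)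
  params w = withVec ⊤-shifts w

  private
    headOf : ∀ {w} → Params (suc w) → ℕ
    headOf (_ , a ∷ _) = a

    headOf-additive : ∀ {w} (x s : Params (suc w)) → headOf (Shifts._⊕_ (params (suc w)) x s) ≡ headOf x + headOf s
    headOf-additive (_ , a ∷ _) (_ , b ∷ _) = ℕP.+-comm b a

    total-additive : ∀ {w} (x s : Vec ℕ w) → total (x ⊕v s) ≡ total x + total s
    total-additive [] [] = refl
    total-additive (a ∷ x) (b ∷ s) rewrite total-additive x s = rearrange a b (total x) (total s)
      where
      open import Data.Nat.Solver as ℕSolver using ()
      open ℕSolver.+-*-Solver renaming (solve to nsolve; _:=_ to _:=ₙ_; _:+_ to _:+ₙ_)
      rearrange : ∀ a b x y → b + a + (x + y) ≡ a + x + (b + y)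
      rearrange = nsolve 4 (λ a b x y → b :+ₙ a :+ₙ (x :+ₙ y) :=ₙ a :+ₙ x :+ₙ (b :+ₙ y)) refl

  -- Σ β(m) is a sum of per-coordinate terms of degree ≤ 2.
  DegLt-betaSum : ∀ r w → Differences.DegLt (params w) 3 (λ p → toℚ (betaSum r (proj₂ p)))
  DegLt-betaSum r zero = Differences.DegLt-zero (params 0) 3 {λ p → toℚ (betaSum r (proj₂ p))} (λ { (tt , []) → toℚ-0 })
  DegLt-betaSum r (suc w) =
    Differences.DegLt-cong (params (suc w)) 3 {term +++ rest} {λ p → toℚ (betaSum r (proj₂ p))} (λ { (tt , a ∷ as) → sym (split a as) })
    (Differences.DegLt-+ (params (suc w)) 3 {term} {rest}
      (Differences.DegLt-+ (params (suc w)) 3 {λ p → toℚ r *ℚ toℚ (headOf p)} {λ p → toℚ n *ℚ toℚ (choose2 (headOf p))}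
        (Differences.DegLt-scale (params (suc w)) 3 (toℚ r) {λ p → toℚ (headOf p)}
          (Differences.DegLt-suc (params (suc w)) 2 {λ p → toℚ (headOf p)} (DegLt-additive (params (suc w)) headOf headOf-additive)))
        (Differences.DegLt-scale (params (suc w)) 3 (toℚ n) {λ p → toℚ (choose2 (headOf p))}
          (DegLt-choose2 (params (suc w)) headOf headOf-additive)))
      (DegLt-pull (params (suc w)) (params w) 3 dropHead dropHead (λ { (tt , a ∷ as) (tt , b ∷ bs) → refl })
         {λ p → toℚ (betaSum (suc r) (proj₂ p))} (DegLt-betaSum (suc r) w)))
    where
    term rest : Params (suc w) → ℚ
    term p = toℚ r *ℚ toℚ (headOf p) +ℚ toℚ n *ℚ toℚ (choose2 (headOf p))
    rest p = toℚ (betaSum (suc r) (tail (proj₂ p)))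
    _+++_ : (Params (suc w) → ℚ) → (Params (suc w) → ℚ) → Params (suc w) → ℚ
    (f +++ g) p = f p +ℚ g p
    dropHead : Params (suc w) → Params w
    dropHead (tt , m) = (tt , tail m)
    split : ∀ a as → toℚ (betaSum r (a ∷ as)) ≡ toℚ r *ℚ toℚ a +ℚ toℚ n *ℚ toℚ (choose2 a) +ℚ toℚ (betaSum (suc r) as)
    split a as = trans (toℚ-+ _ _) (cong (_+ℚ toℚ (betaSum (suc r) as))
                   (trans (toℚ-+ _ _) (cong₂ _+ℚ_ (toℚ-* r a) (toℚ-* n (choose2 a)))))

  sizeℚ : Vec ℕ n' → ℚ
  sizeℚ m = toℚ (betaSum 1 m) -ℚ toℚ (choose2 (total m))

  toℚ-size : ∀ m → toℚ (size (partitionOf m)) ≡ sizeℚ m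
  toℚ-size m = begin
    toℚ (size (partitionOf m))
      ≡⟨ solve 2 (λ a b → a := (a :+ b) :- b) refl (toℚ (size (partitionOf m))) (toℚ (choose2 (total m))) ⟩
    (toℚ (size (partitionOf m)) +ℚ toℚ (choose2 (total m))) -ℚ toℚ (choose2 (total m))
      ≡⟨ cong (_-ℚ toℚ (choose2 (total m))) (trans (sym (toℚ-+ _ _)) (cong toℚ (size-partitionOf m))) ⟩
    toℚ (betaSum 1 m) -ℚ toℚ (choose2 (total m)) ∎
    where open ≡-Reasoning

  DegLt-sizePower : ∀ k → Differences.DegLt (params n') (suc (k * 2)) (λ p → pow (sizeℚ (proj₂ p)) k)
  DegLt-sizePower k = Differences.DegLt-pow (params n') 2 k {λ p → sizeℚ (proj₂ p)}
    (Differences.DegLt-- (params n') 3 {λ p → toℚ (betaSum 1 (proj₂ p))} {λ p → toℚ (choose2 (total (proj₂ p)))}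
       (DegLt-betaSum 1 n')
       (DegLt-choose2 (params n') (λ p → total (proj₂ p)) (λ x s → total-additive (proj₂ x) (proj₂ s))))

-- For d = y + 1 let
-- box y = (εᵢ + y)ᵢ.
module PowerSumOverBox (n' k : ℕ) (ε : ℕ → ℕ) (t : ℕ → ℕ) where
  open import Data.Nat as ℕ using (zero; suc; _+_; _*_; _≤_; _<_; z≤n; s≤s; _^_)
  open import Data.Nat.Properties using (*-comm; +-monoʳ-≤)
  open import Data.Bool using (false)
  open import Data.Unit using (tt)
  open import Data.Vec using (Vec; _∷_)
  open import Data.List using (List; map)
  import Data.List.Properties as LP
  open import Data.Nat.ListAction using (sum)
  open import Data.Product using (_,_; proj₁; proj₂)
  open import Data.Rational using (ℚ)
  open import Data.List.Membership.Propositional using (_∈_; _∉_)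
  open import Data.List.Membership.Propositional.Properties using (∈-map⁺; ∈-map⁻)
  import Data.List.Relation.Unary.Unique.Propositional.Properties as UP
  open import Relation.Binary.PropositionalEquality
  open import Defs
  open NatEmbedding
  open FiniteDifferences
  open Polynomials using (polynomial-from-DegLt)
  open IndependentVectors
  open BetaSets using (betaSet)
  open CoreVectors n'
  open SizeDegree n'

  box : ℕ → Vec ℕ n'
  box y = vecOf n' (λ i → ε i + y)

  F : ℕ → ℚ
  F y = sumIndependent n' false (λ p → pow (sizeℚ (proj₂ p)) k) (tt , box y)

  private
    vecOf-⊕ : ∀ w f h → (vecOf w f ⊕v vecOf w h) ≡ vecOf w (λ i → h i + f i)
    vecOf-⊕ zero f h = refl
    vecOf-⊕ (suc w) f h = cong ((h 0 + f 0) ∷_) (vecOf-⊕ w (λ i → f (suc i)) (λ i → h (suc i)))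

    vecOf-cong : ∀ w {f h} → (∀ i → f i ≡ h i) → vecOf w f ≡ vecOf w h
    vecOf-cong zero e = refl
    vecOf-cong (suc w) e = cong₂ _∷_ (e 0) (vecOf-cong w (λ i → e (suc i)))

    box-shift : ∀ y s → box (s + y) ≡ box y ⊕v vecOf n' (λ _ → s)
    box-shift y s = sym (trans (vecOf-⊕ n' (λ i → ε i + y) (λ _ → s)) (vecOf-cong n' (λ i → swap (ε i) y s)))
      where
      swap : ∀ a y s → s + (a + y) ≡ a + (s + y)
      swap a y s = trans (sym (ℕP.+-assoc s a y)) (trans (cong (_+ y) (ℕP.+-comm s a)) (ℕP.+-assoc a s y))
        where import Data.Nat.Properties as ℕP

  DegLt-F : Differences.DegLt ℕ-shifts (suc (2 * k + suc n' ℕ./ 2)) F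
  DegLt-F = Differences.DegLt-≤ ℕ-shifts {f = F} degree-bound
    (DegLt-pull ℕ-shifts (params n') (suc (k * 2) + maxSupport n' false) (λ y → (tt , box y)) (λ s → (tt , vecOf n' (λ _ → s)))
       (λ y s → cong (tt ,_) (box-shift y s)) {sumIndependent n' false (λ p → pow (sizeℚ (proj₂ p)) k)}
       (DegLt-sumIndependent n' false ⊤-shifts (suc (k * 2)) (λ p → pow (sizeℚ (proj₂ p)) k) (DegLt-sizePower k)))
    where
    degree-bound : suc (k * 2) + maxSupport n' false ≤ suc (2 * k + suc n' ℕ./ 2)
    degree-bound = s≤s (subst (λ z → z + maxSupport n' false ≤ 2 * k + suc n' ℕ./ 2) (*-comm 2 k)
                              (+-monoʳ-≤ (2 * k) (maxSupport≤half n')))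

  cores : ℕ → List (List ℕ)
  cores y = map partitionOf (independentBelow n' false (box y))

  powerSum-cores : ∀ y → powerSum k (cores y) ≡ F y
  powerSum-cores y = begin
    powerSum k (cores y)                                 ≡⟨ sym (toℚ-def _) ⟩
    toℚ (sum (map (λ λs → size λs ^ k) (map partitionOf G))) ≡⟨ cong (λ z → toℚ (sum z)) (sym (LP.map-∘ G)) ⟩
    toℚ (sum (map (λ m → size (partitionOf m) ^ k) G))   ≡⟨ toℚ-sum (λ m → size (partitionOf m) ^ k) G ⟩
    sumℚ (map (λ m → toℚ (size (partitionOf m) ^ k)) G)
      ≡⟨ cong sumℚ (LP.map-cong (λ m → trans (toℚ-^ (size (partitionOf m)) k) (cong (λ z → pow z k) (toℚ-size m))) G) ⟩
    F y                                                  ∎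
    where
    open ≡-Reasoning
    G = independentBelow n' false (box y)

  module _ (box-sound : ∀ y m → IndependentBelow false (box y) m → ∀ i j → j < entry m i → suc i + j * n < t (suc y))
           (box-complete : ∀ y λs → DistinctPartition λs → IsCore n λs → IsCore (t (suc y)) λs →
                           ∀ i → i < n' → suc i + entry (box y) i * n ∉ betaSet λs) where

    enumerates-cores : ∀ y → Enumerates n (t (suc y)) (cores y)
    enumerates-cores y = UP.map⁺ partitionOf-injective (independentBelow-unique n' false (box y)) , λ λs → to λs , from λs
      where
      to : ∀ λs → λs ∈ cores y → InC n (t (suc y)) λs
      to λs lm with ∈-map⁻ partitionOf lm
      ... | m , mm , refl = let below = independentBelow-sound n' false (box y) m mm in
        partitionOf-sound (t (suc y)) m (proj₁ (proj₂ below)) (box-sound y m below)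
      from : ∀ λs → InC n (t (suc y)) λs → λs ∈ cores y
      from λs (dp , nCore , tCore) = subst (_∈ cores y) (C.partitionOf-vector nCore)
        (∈-map⁺ partitionOf (independentBelow-complete n' false (box y) (C.vector nCore)
          (C.vector-below nCore {box y} (box-complete y λs dp nCore tCore) , C.vector-noAdjacent nCore , λ ())))
        where module C = FromCore λs dp

    powerSum-polynomial : PolyInDOfDegAtMost n k t (2 * k + n ℕ./ 2)
    powerSum-polynomial = let (cs , length-cs , evaluates) = polynomial-from-DegLt (2 * k + n ℕ./ 2) F DegLt-F in
      cs , length-cs , λ { (suc y) _ → cores y , enumerates-cores y , trans (powerSum-cores y) (evaluates (suc y) (s≤s z≤n)) }

-- The case t = dn + 1: every coordinate of the box is d.  A position k + 1 + dn in the
-- beta-set of an (n, dn+1)-core would force both k and k + 1 into it.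
module PlusCase (n' k : ℕ) where
  open import Data.Nat as ℕ using (zero; suc; _+_; _*_; _∸_; _≤_; _<_; z≤n; s≤s)
  open import Data.Nat.Properties
  open import Data.List.Membership.Propositional using (_∈_; _∉_)
  open import Data.Product using (_,_)
  open import Data.Empty using (⊥)
  open import Data.Bool using (false)
  open import Relation.Binary.PropositionalEquality
  open import Defs
  open IndependentVectors using (entry; IndependentBelow)
  open BetaSets using (betaSet)
  open CoreVectors n'
  open PowerSumOverBox n' k (λ _ → 1) (λ d → d * n + 1)

  entry-box : ∀ y i → i < n' → entry (box y) i ≡ suc y
  entry-box y i = entry-vecOf n' (λ _ → 1 + y) i

  box-sound : ∀ y m → IndependentBelow false (box y) m → ∀ i j → j < entry m i → suc i + j * n < suc y * n + 1
  box-sound y m (below , _ , _) i j j< = ≤-<-trans (+-mono-≤ (<⇒≤ (s≤s i<n')) (*-monoˡ-≤ n j≤y)) (m<m+n (suc y * n) (s≤s z≤n))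
    where
    i<n' = entry-bound m i j<
    j≤y : j ≤ y
    j≤y = ≤-pred (<-≤-trans j< (≤-trans (below i) (≤-reflexive (entry-box y i i<n'))))

  box-complete : ∀ y λs → DistinctPartition λs → IsCore n λs → IsCore (suc y * n + 1) λs →
                 ∀ i → i < n' → suc i + entry (box y) i * n ∉ betaSet λs
  box-complete y λs dp nCore tCore i i<n' p∈β = consecutive i refl i∈β
    where
    module C = FromCore λs dp
    t = suc y * n + 1
    p∈β' : suc i + suc y * n ∈ betaSet λs
    p∈β' = subst (λ z → suc i + z * n ∈ betaSet λs) (entry-box y i i<n') p∈β
    p≡i+t : suc i + suc y * n ≡ i + t
    p≡i+t = solve 2 (λ i x → con 1 :+ i :+ x := i :+ (x :+ con 1)) refl i (suc y * n)
      where open import Data.Nat.Solver using (module +-*-Solver)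
            open +-*-Solver
    i∈β : i ∈ betaSet λs
    i∈β = subst (_∈ betaSet λs) (trans (cong (_∸ t) p≡i+t) (m+n∸n≡m i t))
            (C.beta-closed-∸ t tCore (subst (0 <_) (+-comm 1 (suc y * n)) (s≤s z≤n)) _ p∈β'
               (≤-trans (m≤n+m t i) (≤-reflexive (sym p≡i+t))))
    consecutive : ∀ q → q ≡ i → q ∈ betaSet λs → ⊥
    consecutive zero _ 0∈β = C.0∉β 0∈β
    consecutive (suc q) refl q∈β = C.βnoConsecutive (suc q) q∈β (C.column-base nCore i (suc y) p∈β')

  theorem : PolyInDOfDegAtMost n k (λ d → d * n + 1) (2 * k + n ℕ./ 2)
  theorem = powerSum-polynomial box-sound box-complete

-- The case t = dn - 1: the box has entries d, except d - 1 in the last coordinate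
-- (i + 1 = n - 1).  There the position n - 1 + (d-1)n = t is a multiple of t; elsewhere a
-- position i + 1 + dn would put both i + 1 and i + 2 into the beta-set of the core.
module MinusCase (n' k : ℕ) where
  open import Data.Nat as ℕ using (suc; _+_; _*_; _∸_; _≤_; _<_; z≤n; s≤s; _≟_)
  open import Data.Nat.Properties
  open import Data.Nat.Divisibility using (_∣_; ∣-refl)
  open import Data.Bool using (false)
  open import Data.Empty using (⊥-elim)
  open import Data.List.Membership.Propositional using (_∈_; _∉_)
  open import Data.Product using (_,_)
  open import Relation.Nullary using (yes; no)
  open import Relation.Binary.PropositionalEquality
  open import Data.Nat.Solver using (module +-*-Solver)
  open +-*-Solver
  open import Defs
  open IndependentVectors using (entry; IndependentBelow)
  open BetaSets using (betaSet)
  open CoreVectors n'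

  offset : ℕ → ℕ
  offset i with suc i ≟ n'
  ... | yes _ = 0
  ... | no _ = 1

  offset-last : ∀ i → suc i ≡ n' → offset i ≡ 0
  offset-last i e with suc i ≟ n'
  ... | yes _ = refl
  ... | no ne = ⊥-elim (ne e)

  offset-other : ∀ i → suc i ≢ n' → offset i ≡ 1
  offset-other i ne with suc i ≟ n'
  ... | yes e = ⊥-elim (ne e)
  ... | no _ = refl

  open PowerSumOverBox n' k offset (λ d → d * n ∸ 1)

  entry-box : ∀ y i → i < n' → entry (box y) i ≡ offset i + y
  entry-box y i = entry-vecOf n' (λ i → offset i + y) i

  box-sound : ∀ y m → IndependentBelow false (box y) m → ∀ i j → j < entry m i → suc i + j * n < suc y * n ∸ 1
  box-sound y m (below , _ , _) i j j< = ∸-monoˡ-≤ 1 two-below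
    where
    i<n' = entry-bound m i j<
    j<box : j < offset i + y
    j<box = <-≤-trans j< (≤-trans (below i) (≤-reflexive (entry-box y i i<n')))
    two-below : suc (suc (suc i + j * n)) ≤ suc y * n
    two-below with suc i ≟ n'
    ... | yes e = ≤-trans (≤-reflexive (cong (λ z → suc (suc z + j * n)) e))
                    (≤-trans (+-monoˡ-≤ (n + j * n) (s≤s z≤n))
                             (+-monoʳ-≤ n (*-monoˡ-≤ n (subst (j <_) (cong (_+ y) (offset-last i e)) j<box))))
    ... | no ne = +-mono-≤ (s≤s (≤∧≢⇒< i<n' ne)) (*-monoˡ-≤ n (≤-pred (subst (j <_) (cong (_+ y) (offset-other i ne)) j<box)))

  box-complete : ∀ y λs → DistinctPartition λs → IsCore n λs → IsCore (suc y * n ∸ 1) λs →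
                 ∀ i → i < n' → suc i + entry (box y) i * n ∉ betaSet λs
  box-complete y λs dp nCore tCore i i<n' p∈β with suc i ≟ n'
  ... | yes e = C.beta-not-multiple _ tCore _ p∈β' (subst ((suc y * n ∸ 1) ∣_) (cong (_+ y * n) (sym e)) ∣-refl)
    where
    module C = FromCore λs dp
    p∈β' : suc i + y * n ∈ betaSet λs
    p∈β' = subst (λ z → suc i + z * n ∈ betaSet λs) (trans (entry-box y i i<n') (cong (_+ y) (offset-last i e))) p∈β
  ... | no ne = C.βnoConsecutive (suc i) (C.column-base nCore i (suc y) p∈β') i+2∈β
    where
    module C = FromCore λs dp
    p∈β' : suc i + suc y * n ∈ betaSet λs
    p∈β' = subst (λ z → suc i + z * n ∈ betaSet λs) (trans (entry-box y i i<n') (cong (_+ y) (offset-other i ne))) p∈β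
    t = n' + y * n
    p≡i+2+t : suc i + suc y * n ≡ suc (suc i) + t
    p≡i+2+t = solve 3 (λ a b c → con 1 :+ a :+ (con 1 :+ b :+ c) := con 1 :+ (con 1 :+ a) :+ (b :+ c)) refl i n' (y * n)
    i+2∈β : suc (suc i) ∈ betaSet λs
    i+2∈β = subst (_∈ betaSet λs) (trans (cong (_∸ t) p≡i+2+t) (m+n∸n≡m (suc (suc i)) t))
              (C.beta-closed-∸ t tCore (≤-trans (≤-trans (s≤s z≤n) i<n') (m≤m+n n' (y * n))) _ p∈β'
                 (≤-trans (m≤n+m t (suc (suc i))) (≤-reflexive (sym p≡i+2+t))))

  theorem : PolyInDOfDegAtMost n k (λ d → d * n ∸ 1) (2 * k + n ℕ./ 2)
  theorem = powerSum-polynomial box-sound box-complete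


open import Defs
open import Data.Nat using (ℕ; suc; _+_; _*_; _∸_; _/_; _≤_; _<_)
open import Data.Product using (_×_; _,_)

theorem1p6 : (n k : ℕ) → 0 < n → 0 < k →
    PolyInDOfDegAtMost n k (λ d → d * n + 1) (2 * k + n / 2)
    × PolyInDOfDegAtMost n k (λ d → d * n ∸ 1) (2 * k + n / 2)
theorem1p6 (suc n') k _ _ = PlusCase.theorem n' k , MinusCase.theorem n' k
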